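{- Let $n$ and $m$ be positive integers with $m\geq n+1$. For every integer $r$ with $0\leq r\leq m-1$, the number of pointed $(n,m)$-lattice paths with pointed non-positive length $r$ equals the number of pointed $(n,m)$-lattice paths with pointed non-positive length $0$, and this number is $\frac{1}{m}\binom{2n}{n}\binom{m}{n+1}$, independent of $r$.
   Context: An $(n,m)$-lattice path is a sequence $P=(x_1,y_1)(x_2,y_2)\cdots(x_{n+1},y_{n+1})$ of vectors in $\mathbb{Z}^2$ such that $1-n\leq y_i\leq 1$ for all $i$, $\sum_{i=1}^{n+1}y_i=1$, $1\leq x_i\leq m-1$ for all $i$, and $\sum_{i=1}^{n+1}x_i=m$. For such $P$, let $NP(P)=\{i\in\{1,\ldots,n+1\}\mid \sum_{j=1}^{i}y_j\leq 0\}$ and $NPL(P)=\sum_{i\in NP(P)}x_i$. A pointed $(n,m)$-lattice path is a pair $\dot{P}=[P;j]$ where $P$ is an $(n,m)$-lattice path and $j$ is an integer with $0\leq j\leq x_{n+1}-1$; its pointed non-positive length is $PNPL(\dot{P})=NPL(P)+j$. -}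

module Defs where

open import Data.Nat as ℕ using (ℕ; suc)
open import Data.Integer using (ℤ; +_; _+_; _-_; _≤_; _≤ᵇ_; 0ℤ; 1ℤ)
open import Data.Product using (_×_; proj₁; proj₂; Σ)
open import Data.Vec using (Vec; []; _∷_; last; map; foldr)
open import Data.Vec.Relation.Unary.All using (All)
open import Data.Bool using (if_then_else_)
open import Relation.Binary.PropositionalEquality using (_≡_)

sumℤ : ∀ {k} → Vec ℤ k → ℤ
sumℤ = foldr _ _+_ 0ℤ

record LatticePath (n m : ℕ) : Set where
  constructor mkPath
  field
    steps  : Vec (ℤ × ℤ) (suc n)
    yBound : All (λ s → ((1ℤ - + n) ≤ proj₂ s) × (proj₂ s ≤ 1ℤ)) steps
    ySum   : sumℤ (map proj₂ steps) ≡ 1ℤ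
    xBound : All (λ s → (1ℤ ≤ proj₁ s) × (proj₁ s ≤ (+ m - 1ℤ))) steps
    xSum   : sumℤ (map proj₁ steps) ≡ + m
open LatticePath public

-- sum of xᵢ over those i whose prefix sum y₁+…+yᵢ is ≤ 0;
-- acc is the prefix sum of the y's already consumed
nplFrom : ∀ {k} → ℤ → Vec (ℤ × ℤ) k → ℤ
nplFrom acc [] = 0ℤ
nplFrom acc (s ∷ ss) =
  (if (acc + proj₂ s) ≤ᵇ 0ℤ then proj₁ s else 0ℤ) + nplFrom (acc + proj₂ s) ss

NPL : ∀ {n m} → LatticePath n m → ℤ
NPL P = nplFrom 0ℤ (steps P)

lastX : ∀ {n m} → LatticePath n m → ℤ
lastX P = proj₁ (last (steps P))

record PointedPath (n m : ℕ) : Set where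
  constructor pointed
  field
    path  : LatticePath n m
    j     : ℤ
    jLow  : 0ℤ ≤ j
    jHigh : j ≤ lastX path - 1ℤ
open PointedPath public

PNPL : ∀ {n m} → PointedPath n m → ℤ
PNPL P = NPL (path P) + j P

PointedWithPNPL : ℕ → ℕ → ℤ → Set
PointedWithPNPL n m r = Σ (PointedPath n m) (λ P → PNPL P ≡ r)

-- Rotating the steps of a lattice path cyclically gives again a lattice path, and by the cycle
-- lemma exactly one rotation of each path has NPL 0: the one starting at the last lowest point,
-- after which the path stays strictly above its starting height. Fix such a path, with steps
-- x₀, …, xₙ, and cut [0, m) into consecutive blocks of lengths xₜ. A point c in block t yields a
-- pointed path: rotate so that step t comes last and point at the number of points of the block
-- after c. Its PNPL is the rank of c when the points are ordered by the height after their step,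
-- ties broken backwards, so as c runs through [0, m) the PNPL takes every value in [0, m) once.
-- Hence pointed paths ≅ (paths with NPL 0) × Fin m with PNPL as second coordinate, all fibres
-- PNPL = r have the same size N, and m N is the number of pointed paths, C(2n, n) C(m, n + 1),
-- counted as weak compositions via y ↦ 1 − y and x ↦ x − 1, the pointer splitting the last part.

module Submission where

open import Algebra.Core using (Op₂)
open import Algebra.Structures using (IsMonoid)
open import Axiom.UniquenessOfIdentityProofs using (module Decidable⇒UIP)
open import Data.Bool using (Bool; true; false; T; if_then_else_)
open import Data.Empty using (⊥)
open import Data.Fin as Fin using (Fin; toℕ; fromℕ<)
import Data.Fin.Properties as Fin
open import Data.Fin.Permutation using (↔⇒≡)
open import Data.Integer as ℤ using (ℤ; +_; 0ℤ; 1ℤ; ∣_∣)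
import Data.Integer.Properties as ℤ
open import Algebra.Properties.AbelianGroup ℤ.+-0-abelianGroup using (∙-cancelˡ; xyx⁻¹≈y)
open import Data.Integer.Tactic.RingSolver using (solve-∀)
open import Data.Nat as ℕ using (ℕ; zero; suc; _+_; _∸_; _*_; _≤_; _<_; z≤n; s≤s; z<s; s<s)
import Data.Nat.Properties as ℕ
open import Data.Nat.Combinatorics using (_C_; nCn≡1; nCk+nC[k+1]≡[n+1]C[k+1])
open import Data.Nat.DivMod using (_%_; m<n⇒m%n≡m; [m+n]%n≡m%n; %-distribˡ-+; m%n%n≡m%n; m%n<n)
open import Data.Product using (Σ; ∃; _×_; _,_; proj₁; proj₂)
open import Data.Product.Function.Dependent.Propositional using (Σ-↔)
open import Data.Product.Function.NonDependent.Propositional using (_×-↔_)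
open import Data.Sum using (_⊎_; inj₁; inj₂; [_,_])
open import Data.Sum.Function.Propositional using (_⊎-↔_)
open import Data.Vec using (Vec; []; _∷_; _∷ʳ_; map; sum; zip; init; last; initLast)
import Data.Vec.Properties as Vec
open import Data.Vec.Relation.Unary.All as All using (All; []; _∷_)
import Data.Vec.Relation.Unary.All.Properties as All
open import Function using (_∘_; id)
open import Function.Bundles using (_↔_; _⇔_; mk↔ₛ′; mk⇔; Inverse; Equivalence)
open import Function.Definitions using (Injective)
open import Function.Properties.Inverse using (↔-trans; ↔-sym; ↔-refl)
open import Relation.Binary using (tri<; tri≈; tri>)
open import Relation.Binary.PropositionalEquality hiding ([_])
open import Relation.Nullary using (Dec; yes; no; contradiction)
open import Relation.Nullary.Decidable using (does; does-⇔; dec-true; dec-false)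
open import Defs

module InitialSums {A : Set} {_∙_ : Op₂ A} {ε : A} (isMonoid : IsMonoid _≡_ _∙_ ε) where
  open IsMonoid isMonoid using (assoc; identityˡ; identityʳ)

  ∑ : (ℕ → A) → ℕ → A
  ∑ f zero    = ε
  ∑ f (suc t) = f 0 ∙ ∑ (f ∘ suc) t

  ∑-cong : ∀ t {f g : ℕ → A} → (∀ i → i < t → f i ≡ g i) → ∑ f t ≡ ∑ g t
  ∑-cong zero    f≗g = refl
  ∑-cong (suc t) f≗g = cong₂ _∙_ (f≗g 0 z<s) (∑-cong t (λ i i<t → f≗g (suc i) (s<s i<t)))

  ∑-+ : ∀ a b (f : ℕ → A) → ∑ f (a + b) ≡ ∑ f a ∙ ∑ (λ i → f (a + i)) b
  ∑-+ zero    b f = sym (identityˡ _)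
  ∑-+ (suc a) b f = trans (cong (f 0 ∙_) (∑-+ a b (f ∘ suc))) (sym (assoc (f 0) _ _))

  ∑-suc : ∀ t (f : ℕ → A) → ∑ f (suc t) ≡ ∑ f t ∙ f t
  ∑-suc t f = begin
    ∑ f (suc t)                               ≡⟨ cong (∑ f) (ℕ.+-comm 1 t) ⟩
    ∑ f (t + 1)                               ≡⟨ ∑-+ t 1 f ⟩
    ∑ f t ∙ (f (t + 0) ∙ ε)                   ≡⟨ cong (∑ f t ∙_) (identityʳ _) ⟩
    ∑ f t ∙ f (t + 0)                         ≡⟨ cong (λ s → ∑ f t ∙ f s) (ℕ.+-identityʳ t) ⟩
    ∑ f t ∙ f t                               ∎
    where open ≡-Reasoning

  ∑-ε : ∀ t (f : ℕ → A) → (∀ i → i < t → f i ≡ ε) → ∑ f t ≡ ε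
  ∑-ε zero    f f≡ε = refl
  ∑-ε (suc t) f f≡ε =
    trans (cong₂ _∙_ (f≡ε 0 z<s) (∑-ε t (f ∘ suc) (λ i i<t → f≡ε (suc i) (s<s i<t)))) (identityˡ ε)

module Sumℕ = InitialSums ℕ.+-0-isMonoid
module Sumℤ = InitialSums ℤ.+-0-isMonoid

pos-∑ : ∀ t (f : ℕ → ℕ) → + Sumℕ.∑ f t ≡ Sumℤ.∑ (λ i → + f i) t
pos-∑ zero    f = refl
pos-∑ (suc t) f = trans (ℤ.pos-+ (f 0) _) (cong (λ s → + f 0 ℤ.+ s) (pos-∑ t (f ∘ suc)))

∑-mono : ∀ t {f g : ℕ → ℕ} → (∀ i → i < t → f i ≤ g i) → Sumℕ.∑ f t ≤ Sumℕ.∑ g t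
∑-mono zero    f≤g = z≤n
∑-mono (suc t) f≤g = ℕ.+-mono-≤ (f≤g 0 z<s) (∑-mono t (λ i i<t → f≤g (suc i) (s<s i<t)))

∑-mono-< : ∀ t {f g : ℕ → ℕ} → (∀ i → i < t → f i ≤ g i) → ∀ j → j < t → f j < g j →
           Sumℕ.∑ f t < Sumℕ.∑ g t
∑-mono-< (suc t) f≤g zero    _         f<g = ℕ.+-mono-<-≤ f<g (∑-mono t (λ i i<t → f≤g (suc i) (s<s i<t)))
∑-mono-< (suc t) f≤g (suc j) (s<s j<t) f<g =
  ℕ.+-mono-≤-< (f≤g 0 z<s) (∑-mono-< t (λ i i<t → f≤g (suc i) (s<s i<t)) j j<t f<g)

-- X = Sumℕ.∑ x cuts [0, X s) into the blocks [X t, X (t + 1)).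
∑-blocks : ∀ (f x : ℕ → ℕ) s →
  Sumℕ.∑ f (Sumℕ.∑ x s) ≡ Sumℕ.∑ (λ t → Sumℕ.∑ (λ u → f (Sumℕ.∑ x t + u)) (x t)) s
∑-blocks f x zero    = refl
∑-blocks f x (suc s) = begin
  Sumℕ.∑ f (Sumℕ.∑ x (suc s))                                        ≡⟨ cong (Sumℕ.∑ f) (Sumℕ.∑-suc s x) ⟩
  Sumℕ.∑ f (Sumℕ.∑ x s + x s)                                         ≡⟨ Sumℕ.∑-+ (Sumℕ.∑ x s) (x s) f ⟩
  Sumℕ.∑ f (Sumℕ.∑ x s) + block s                                     ≡⟨ cong (_+ block s) (∑-blocks f x s) ⟩
  Sumℕ.∑ block s + block s                                            ≡⟨ Sumℕ.∑-suc s block ⟨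
  Sumℕ.∑ block (suc s)                                                ∎
  where
  open ≡-Reasoning
  block : ℕ → ℕ
  block t = Sumℕ.∑ (λ u → f (Sumℕ.∑ x t + u)) (x t)

indicator : Bool → ℕ
indicator b = if b then 1 else 0

count : (ℕ → Bool) → ℕ → ℕ
count p = Sumℕ.∑ (indicator ∘ p)

∑-const : ∀ t k → Sumℕ.∑ (λ _ → k) t ≡ t * k
∑-const zero    k = refl
∑-const (suc t) k = cong (λ s → k + s) (∑-const t k)

count-const : ∀ t {p : ℕ → Bool} β → (∀ i → i < t → p i ≡ β) → count p t ≡ t * indicator β
count-const t β p≡β = trans (Sumℕ.∑-cong t (λ i i<t → cong indicator (p≡β i i<t))) (∑-const t (indicator β))

count-< : ∀ t (p : ℕ → Bool) j → j < t → p j ≡ false → count p t < t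
count-< t p j j<t pj≡false = subst (count p t <_) (trans (∑-const t 1) (ℕ.*-identityʳ t))
  (∑-mono-< t (λ i _ → indicator≤1 (p i)) j j<t (subst (λ b → indicator b < 1) (sym pj≡false) z<s))
  where
  indicator≤1 : ∀ b → indicator b ≤ 1
  indicator≤1 true  = s≤s z≤n
  indicator≤1 false = z≤n

count-mono-< : ∀ t (p q : ℕ → Bool) → (∀ i → i < t → p i ≡ true → q i ≡ true) →
               ∀ j → j < t → p j ≡ false → q j ≡ true → count p t < count q t
count-mono-< t p q p⇒q j j<t pj≡false qj≡true =
  ∑-mono-< t (λ i i<t → indicator-mono (p i) (q i) (p⇒q i i<t)) j j<t
    (subst₂ (λ a b → indicator a < indicator b) (sym pj≡false) (sym qj≡true) z<s)
  where
  indicator-mono : ∀ a b → (a ≡ true → b ≡ true) → indicator a ≤ indicator b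
  indicator-mono false b     _   = z≤n
  indicator-mono true  true  _   = s≤s z≤n
  indicator-mono true  false a⇒b with () ← a⇒b refl

∑-nonNeg : ∀ t (f : ℕ → ℤ) → (∀ j → j < t → 0ℤ ℤ.≤ f j) → 0ℤ ℤ.≤ Sumℤ.∑ f t
∑-nonNeg zero    f 0≤f = ℤ.≤-refl
∑-nonNeg (suc t) f 0≤f = ℤ.+-mono-≤ (0≤f 0 z<s) (∑-nonNeg t (f ∘ suc) (λ j j<t → 0≤f (suc j) (s<s j<t)))

∑-nonNeg-≤ : ∀ t (f : ℕ → ℤ) → (∀ j → j < t → 0ℤ ℤ.≤ f j) → ∀ i → i < t → f i ℤ.≤ Sumℤ.∑ f t
∑-nonNeg-≤ (suc t) f 0≤f zero _ = subst (ℤ._≤ f 0 ℤ.+ Sumℤ.∑ (f ∘ suc) t) (ℤ.+-identityʳ (f 0))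
  (ℤ.+-monoʳ-≤ (f 0) (∑-nonNeg t (f ∘ suc) (λ j j<t → 0≤f (suc j) (s<s j<t))))
∑-nonNeg-≤ (suc t) f 0≤f (suc i) (s<s i<t) = subst (ℤ._≤ f 0 ℤ.+ Sumℤ.∑ (f ∘ suc) t) (ℤ.+-identityˡ (f (suc i)))
  (ℤ.+-mono-≤ (0≤f 0 z<s) (∑-nonNeg-≤ t (f ∘ suc) (λ j j<t → 0≤f (suc j) (s<s j<t)) i i<t))

ℤ-≡-irrelevant : ∀ {a b : ℤ} (p q : a ≡ b) → p ≡ q
ℤ-≡-irrelevant = Decidable⇒UIP.≡-irrelevant ℤ._≟_

≤×≤-irrelevant : ∀ {a b c d : ℤ} (p q : (a ℤ.≤ b) × (c ℤ.≤ d)) → p ≡ q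
≤×≤-irrelevant (p₁ , p₂) (q₁ , q₂) = cong₂ _,_ (ℤ.≤-irrelevant p₁ q₁) (ℤ.≤-irrelevant p₂ q₂)

m∸suc[m∸suc[n]]≡n : ∀ {m n} → suc n ≤ m → m ∸ suc (m ∸ suc n) ≡ n
m∸suc[m∸suc[n]]≡n {m} {n} 1+n≤m = begin
  m ∸ suc (m ∸ suc n)     ≡⟨ cong (m ∸_) (ℕ.+-comm 1 (m ∸ suc n)) ⟩
  m ∸ (m ∸ suc n + 1)     ≡⟨ ℕ.∸-+-assoc m (m ∸ suc n) 1 ⟨
  m ∸ (m ∸ suc n) ∸ 1     ≡⟨ cong (_∸ 1) (ℕ.m∸[m∸n]≡n 1+n≤m) ⟩
  n                       ∎
  where open ≡-Reasoning

ifNonPos : ℤ → ℤ → ℤ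
ifNonPos a b = if a ℤ.≤ᵇ 0ℤ then b else 0ℤ

ifNonPos-≤ : ∀ {a} b → a ℤ.≤ 0ℤ → ifNonPos a b ≡ b
ifNonPos-≤ {a} b a≤0 with a ℤ.≤ᵇ 0ℤ | ℤ.≤⇒≤ᵇ a≤0
... | true | _ = refl

ifNonPos-> : ∀ {a} b → 0ℤ ℤ.< a → ifNonPos a b ≡ 0ℤ
ifNonPos-> {a} b 0<a with a ℤ.≤ᵇ 0ℤ in eq
... | false = refl
... | true  = contradiction (ℤ.≤ᵇ⇒≤ (subst T (sym eq) _)) (ℤ.<⇒≱ 0<a)

ifNonPos-nonNeg : ∀ a {b} → 0ℤ ℤ.≤ b → 0ℤ ℤ.≤ ifNonPos a b
ifNonPos-nonNeg a 0≤b with a ℤ.≤ᵇ 0ℤ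
... | true  = 0≤b
... | false = ℤ.≤-refl

i<j⇒0<j-i : ∀ {i j} → i ℤ.< j → 0ℤ ℤ.< j ℤ.- i
i<j⇒0<j-i {i} {j} i<j = subst (ℤ._< j ℤ.- i) (ℤ.+-inverseʳ i) (ℤ.+-monoˡ-< (ℤ.- i) i<j)

≤-1⇒< : ∀ {i j} → i ℤ.≤ j ℤ.- 1ℤ → i ℤ.< j
≤-1⇒< {i} {j} i≤j-1 = ℤ.i≤pred[j]⇒i<j (subst (i ℤ.≤_) (ℤ.+-comm j ℤ.-1ℤ) i≤j-1)

ifNonPos-≤? : ∀ A B w → ifNonPos (A ℤ.- B) (+ w) ≡ + (w * indicator (does (A ℤ.≤? B)))
ifNonPos-≤? A B w with A ℤ.≤? B
... | yes A≤B = trans (ifNonPos-≤ (+ w) (ℤ.i≤j⇒i-j≤0 A≤B)) (cong +_ (sym (ℕ.*-identityʳ w)))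
... | no  A≰B = trans (ifNonPos-> (+ w) (i<j⇒0<j-i (ℤ.≰⇒> A≰B))) (cong +_ (sym (ℕ.*-zeroʳ w)))

ifNonPos-<? : ∀ A B w → ifNonPos (1ℤ ℤ.+ A ℤ.- B) (+ w) ≡ + (w * indicator (does (A ℤ.<? B)))
ifNonPos-<? A B w with A ℤ.<? B
... | yes A<B = trans (ifNonPos-≤ (+ w) (ℤ.i≤j⇒i-j≤0 (ℤ.i<j⇒suc[i]≤j A<B))) (cong +_ (sym (ℕ.*-identityʳ w)))
... | no  A≮B = trans (ifNonPos-> (+ w) (i<j⇒0<j-i (ℤ.≤-<-trans (ℤ.≮⇒≥ A≮B) (ℤ.suc[i]≤j⇒i<j ℤ.≤-refl))))
                      (cong +_ (sym (ℕ.*-zeroʳ w)))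

-- For 0 ≤ c < m, lexKey m A c orders the pairs (A, c) by A, and then by c decreasingly.
lexKey : ℕ → ℤ → ℕ → ℤ
lexKey m A c = + m ℤ.* A ℤ.- + c

module _ {m : ℕ} where

  lexKey-<ˡ : ∀ {A B c c′} → A ℤ.< B → c′ < m → lexKey m A c ℤ.< lexKey m B c′
  lexKey-<ˡ {A} {B} {c} {c′} A<B c′<m = begin-strict
    + m ℤ.* A ℤ.- + c               ≤⟨ ℤ.i-j≤i (+ m ℤ.* A) (+ c) ⟩
    + m ℤ.* A                       ≡⟨ ℤ.+-identityʳ _ ⟨
    + m ℤ.* A ℤ.+ 0ℤ                <⟨ ℤ.+-monoʳ-< (+ m ℤ.* A) (i<j⇒0<j-i (ℤ.+<+ c′<m)) ⟩
    + m ℤ.* A ℤ.+ (+ m ℤ.- + c′)    ≡⟨ shift (+ m) A (+ c′) ⟩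
    + m ℤ.* (1ℤ ℤ.+ A) ℤ.- + c′     ≤⟨ ℤ.+-monoˡ-≤ (ℤ.- + c′) (ℤ.*-monoˡ-≤-nonNeg (+ m) (ℤ.i<j⇒suc[i]≤j A<B)) ⟩
    + m ℤ.* B ℤ.- + c′              ∎
    where
    open ℤ.≤-Reasoning
    shift : ∀ M A C → M ℤ.* A ℤ.+ (M ℤ.- C) ≡ M ℤ.* (1ℤ ℤ.+ A) ℤ.- C
    shift = solve-∀

  lexKey-<ʳ : ∀ {A c c′} → c′ < c → lexKey m A c ℤ.< lexKey m A c′
  lexKey-<ʳ {A} c′<c = ℤ.+-monoʳ-< (+ m ℤ.* A) (ℤ.neg-mono-< (ℤ.+<+ c′<c))

  lexKey-<⇔ : ∀ {A B c c′} → c < m → c′ < m →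
              lexKey m A c ℤ.< lexKey m B c′ ⇔ (A ℤ.< B ⊎ (A ≡ B × c′ < c))
  lexKey-<⇔ {A} {B} {c} {c′} c<m c′<m = mk⇔ to from
    where
    from : A ℤ.< B ⊎ (A ≡ B × c′ < c) → lexKey m A c ℤ.< lexKey m B c′
    from (inj₁ A<B)          = lexKey-<ˡ A<B c′<m
    from (inj₂ (refl , c′<c)) = lexKey-<ʳ c′<c
    to : lexKey m A c ℤ.< lexKey m B c′ → A ℤ.< B ⊎ (A ≡ B × c′ < c)
    to key< with ℤ.<-cmp A B | ℕ.<-cmp c′ c
    ... | tri< A<B _ _ | _              = inj₁ A<B
    ... | tri≈ _ A≡B _ | tri< c′<c _ _ = inj₂ (A≡B , c′<c)
    ... | tri≈ _ refl _ | tri≈ _ refl _ = contradiction key< (ℤ.<-irrefl refl)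
    ... | tri≈ _ refl _ | tri> _ _ c<c′ = contradiction key< (ℤ.<-asym (lexKey-<ʳ c<c′))
    ... | tri> _ _ B<A | _              = contradiction key< (ℤ.<-asym (lexKey-<ˡ B<A c<m))

  lexKey-injective : ∀ {A B c c′} → c < m → c′ < m → lexKey m A c ≡ lexKey m B c′ → c ≡ c′
  lexKey-injective {A} {B} {c} {c′} c<m c′<m key≡ with ℤ.<-cmp A B | ℕ.<-cmp c c′
  ... | _              | tri≈ _ c≡c′ _ = c≡c′
  ... | tri< A<B _ _   | _             = contradiction key≡ (ℤ.<⇒≢ (lexKey-<ˡ A<B c′<m))
  ... | tri> _ _ B<A   | _             = contradiction (sym key≡) (ℤ.<⇒≢ (lexKey-<ˡ B<A c<m))
  ... | tri≈ _ refl _  | tri< c<c′ _ _ = contradiction (sym key≡) (ℤ.<⇒≢ (lexKey-<ʳ c<c′))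
  ... | tri≈ _ refl _  | tri> _ _ c′<c = contradiction key≡ (ℤ.<⇒≢ (lexKey-<ʳ c′<c))

lastArgmin : (f : ℕ → ℤ) (N : ℕ) →
  Σ ℕ λ k → k ≤ N × (∀ i → i ≤ N → f k ℤ.≤ f i) × (∀ i → k < i → i ≤ N → f k ℤ.< f i)
lastArgmin f zero = 0 , z≤n , (λ { .0 z≤n → ℤ.≤-refl }) , (λ { i i>0 z≤n → contradiction i>0 (ℕ.<-irrefl refl) })
lastArgmin f (suc N) with lastArgmin f N
... | k , k≤N , min , strict with f (suc N) ℤ.≤? f k
...   | yes fN≤fk = suc N , ℕ.≤-refl , new-min , (λ i N<i i≤N → contradiction i≤N (ℕ.<⇒≱ N<i))
  where
  new-min : ∀ i → i ≤ suc N → f (suc N) ℤ.≤ f i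
  new-min i i≤1+N with ℕ.m≤n⇒m<n∨m≡n i≤1+N
  ... | inj₁ i<1+N = ℤ.≤-trans fN≤fk (min i (ℕ.≤-pred i<1+N))
  ... | inj₂ refl  = ℤ.≤-refl
...   | no  fN≰fk = k , ℕ.m≤n⇒m≤1+n k≤N , min′ , strict′
  where
  fk<fN : f k ℤ.< f (suc N)
  fk<fN = ℤ.≰⇒> fN≰fk
  min′ : ∀ i → i ≤ suc N → f k ℤ.≤ f i
  min′ i i≤1+N with ℕ.m≤n⇒m<n∨m≡n i≤1+N
  ... | inj₁ i<1+N = min i (ℕ.≤-pred i<1+N)
  ... | inj₂ refl  = ℤ.<⇒≤ fk<fN
  strict′ : ∀ i → k < i → i ≤ suc N → f k ℤ.< f i
  strict′ i k<i i≤1+N with ℕ.m≤n⇒m<n∨m≡n i≤1+N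
  ... | inj₁ i<1+N = strict i k<i (ℕ.≤-pred i<1+N)
  ... | inj₂ refl  = fk<fN

stepOf : (ℕ → ℕ) → ℕ → ℕ → ℕ
stepOf f zero    c = 0
stepOf f (suc N) c with c ℕ.<? f N
... | yes _ = stepOf f N c
... | no  _ = N

stepOf-spec : ∀ (f : ℕ → ℕ) N {c} → f 0 ≡ 0 → c < f N →
              stepOf f N c < N × f (stepOf f N c) ≤ c × c < f (suc (stepOf f N c))
stepOf-spec f zero    f0≡0 c<f0 = contradiction (subst (_ <_) f0≡0 c<f0) ℕ.n≮0
stepOf-spec f (suc N) {c} f0≡0 c<fN+1 with c ℕ.<? f N
... | yes c<fN = let s<N , fs≤c , c<fs+1 = stepOf-spec f N f0≡0 c<fN in ℕ.m≤n⇒m≤1+n s<N , fs≤c , c<fs+1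
... | no  c≮fN = ℕ.≤-refl , ℕ.≮⇒≥ c≮fN , c<fN+1

step-unique : ∀ (f : ℕ → ℕ) → (∀ {a b} → a ≤ b → f a ≤ f b) → ∀ {c t t′} →
              f t ≤ c → c < f (suc t) → f t′ ≤ c → c < f (suc t′) → t ≡ t′
step-unique f f-mono {c} {t} {t′} ft≤c c<ft+1 ft′≤c c<ft′+1 with ℕ.<-cmp t t′
... | tri< t<t′ _ _ = contradiction (ℕ.≤-trans (f-mono t<t′) ft′≤c) (ℕ.<⇒≱ c<ft+1)
... | tri≈ _ t≡t′ _ = t≡t′
... | tri> _ _ t′<t = contradiction (ℕ.≤-trans (f-mono t′<t) ft≤c) (ℕ.<⇒≱ c<ft′+1)

injective⇒surjective : ∀ {k} (f : Fin k → Fin k) → Injective _≡_ _≡_ f → ∀ r → ∃ λ i → f i ≡ r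
injective⇒surjective {suc k} f f-inj r with Fin.any? (λ i → f i Fin.≟ r)
... | yes hit = hit
... | no  miss = contradiction (Fin.injective⇒≤ avoid-r-injective) (ℕ.<-irrefl refl)
  where
  avoid-r : Fin (suc k) → Fin k
  avoid-r i = Fin.punchOut {i = r} {j = f i} (λ r≡fi → miss (i , sym r≡fi))
  avoid-r-injective : Injective _≡_ _≡_ avoid-r
  avoid-r-injective {i} {j} =
    f-inj ∘ Fin.punchOut-injective {i = r} (λ r≡fi → miss (i , sym r≡fi)) (λ r≡fj → miss (j , sym r≡fj))

injective⇒↔ : ∀ {k} (f : Fin k → Fin k) → Injective _≡_ _≡_ f → Fin k ↔ Fin k
injective⇒↔ f f-inj = mk↔ₛ′ f (proj₁ ∘ surj) (proj₂ ∘ surj) (λ i → f-inj (proj₂ (surj (f i))))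
  where
  surj : ∀ r → ∃ λ i → f i ≡ r
  surj = injective⇒surjective f f-inj

module Ranking (m : ℕ) (key : ℕ → ℤ) (key-injective : ∀ {c d} → c < m → d < m → key c ≡ key d → c ≡ d) where

  below : ℕ → ℕ → Bool
  below c c′ = does (key c′ ℤ.<? key c)

  rank : ℕ → ℕ
  rank c = count (below c) m

  below-irrefl : ∀ c → below c c ≡ false
  below-irrefl c with key c ℤ.<? key c
  ... | yes kc<kc = contradiction kc<kc (ℤ.<-irrefl refl)
  ... | no  _     = refl

  rank-< : ∀ {c} → c < m → rank c < m
  rank-< {c} c<m = count-< m (below c) c c<m (below-irrefl c)

  below-sound : ∀ {c c′} → below c c′ ≡ true → key c′ ℤ.< key c
  below-sound {c} {c′} _ with key c′ ℤ.<? key c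
  ... | yes k′<k = k′<k

  rank-mono : ∀ {c d} → c < m → key c ℤ.< key d → rank c < rank d
  rank-mono {c} {d} c<m kc<kd = count-mono-< m (below c) (below d)
    (λ _ _ c′-below-c → dec-true (_ ℤ.<? key d) (ℤ.<-trans (below-sound c′-below-c) kc<kd))
    c c<m (below-irrefl c) (dec-true (key c ℤ.<? key d) kc<kd)

  rank-injective : ∀ {c d} → c < m → d < m → rank c ≡ rank d → c ≡ d
  rank-injective {c} {d} c<m d<m rc≡rd with ℤ.<-cmp (key c) (key d)
  ... | tri< kc<kd _ _ = contradiction rc≡rd (ℕ.<⇒≢ (rank-mono c<m kc<kd))
  ... | tri≈ _ kc≡kd _ = key-injective c<m d<m kc≡kd
  ... | tri> _ _ kd<kc = contradiction (sym rc≡rd) (ℕ.<⇒≢ (rank-mono d<m kd<kc))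

  rankFin : Fin m → Fin m
  rankFin i = fromℕ< (rank-< (Fin.toℕ<n i))

  toℕ-rankFin : ∀ i → toℕ (rankFin i) ≡ rank (toℕ i)
  toℕ-rankFin i = Fin.toℕ-fromℕ< _

  rank↔ : Fin m ↔ Fin m
  rank↔ = injective⇒↔ rankFin λ {i} {j} eq → Fin.toℕ-injective
    (rank-injective (Fin.toℕ<n i) (Fin.toℕ<n j) (trans (sym (toℕ-rankFin i)) (trans (cong toℕ eq) (toℕ-rankFin j))))

Σ-Fin-filter : ∀ a (P : Fin a → Set) → (∀ i → Dec (P i)) → (∀ i (p q : P i) → p ≡ q) →
               Σ ℕ (λ N → Fin N ↔ Σ (Fin a) P)
Σ-Fin-filter zero    P P? P-irr = 0 , mk↔ₛ′ (λ ()) (λ { (() , _) }) (λ { (() , _) }) (λ ())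
Σ-Fin-filter (suc a) P P? P-irr with Σ-Fin-filter a (P ∘ Fin.suc) (P? ∘ Fin.suc) (P-irr ∘ Fin.suc) | P? Fin.zero
... | N , e | yes p₀ = suc N , mk↔ₛ′ to from to-from from-to
  where
  open Inverse e using () renaming (to to e-to; from to e-from; strictlyInverseˡ to e-to-from; strictlyInverseʳ to e-from-to)
  to : Fin (suc N) → Σ (Fin (suc a)) P
  to Fin.zero    = Fin.zero , p₀
  to (Fin.suc i) = Fin.suc (proj₁ (e-to i)) , proj₂ (e-to i)
  from : Σ (Fin (suc a)) P → Fin (suc N)
  from (Fin.zero  , _) = Fin.zero
  from (Fin.suc k , q) = Fin.suc (e-from (k , q))
  to-from : ∀ s → to (from s) ≡ s
  to-from (Fin.zero  , q) = cong (Fin.zero ,_) (P-irr Fin.zero p₀ q)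
  to-from (Fin.suc k , q) = cong (λ s → Fin.suc (proj₁ s) , proj₂ s) (e-to-from (k , q))
  from-to : ∀ i → from (to i) ≡ i
  from-to Fin.zero    = refl
  from-to (Fin.suc i) = cong Fin.suc (e-from-to i)
... | N , e | no ¬p₀ = N , mk↔ₛ′ to from to-from from-to
  where
  open Inverse e using () renaming (to to e-to; from to e-from; strictlyInverseˡ to e-to-from; strictlyInverseʳ to e-from-to)
  to : Fin N → Σ (Fin (suc a)) P
  to i = Fin.suc (proj₁ (e-to i)) , proj₂ (e-to i)
  from : Σ (Fin (suc a)) P → Fin N
  from (Fin.zero  , q) = contradiction q ¬p₀
  from (Fin.suc k , q) = e-from (k , q)
  to-from : ∀ s → to (from s) ≡ s
  to-from (Fin.zero  , q) = contradiction q ¬p₀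
  to-from (Fin.suc k , q) = cong (λ s → Fin.suc (proj₁ s) , proj₂ s) (e-to-from (k , q))
  from-to : ∀ i → from (to i) ≡ i
  from-to = e-from-to

fibre↔ : ∀ {A B : Set} {m} (e : (A × Fin m) ↔ B) (f : B → ℤ) →
         (∀ a i → f (Inverse.to e (a , i)) ≡ + toℕ i) → ∀ {r} → r < m → Σ B (λ b → f b ≡ + r) ↔ A
fibre↔ {A} {B} {m} e f f-to {r} r<m = mk↔ₛ′ to from to-from from-to
  where
  open Inverse e using () renaming (to to e-to; from to e-from; strictlyInverseˡ to e-to-from; strictlyInverseʳ to e-from-to)
  r′ : Fin m
  r′ = fromℕ< r<m
  to : Σ B (λ b → f b ≡ + r) → A
  to (b , _) = proj₁ (e-from b)
  from : A → Σ B (λ b → f b ≡ + r)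
  from a = e-to (a , r′) , trans (f-to a r′) (cong +_ (Fin.toℕ-fromℕ< r<m))
  to-from : ∀ a → to (from a) ≡ a
  to-from a = cong proj₁ (e-from-to (a , r′))
  from-to : ∀ s → from (to s) ≡ s
  from-to (b , fb≡r) = Σ-≡ (trans (cong (λ i → e-to (proj₁ (e-from b) , i)) r′≡) (e-to-from b))
    where
    r′≡ : r′ ≡ proj₂ (e-from b)
    r′≡ = Fin.toℕ-injective (ℤ.+-injective (begin
      + toℕ r′                                ≡⟨ cong +_ (Fin.toℕ-fromℕ< r<m) ⟩
      + r                                     ≡⟨ fb≡r ⟨
      f b                                     ≡⟨ cong f (e-to-from b) ⟨
      f (e-to (e-from b))                     ≡⟨ f-to (proj₁ (e-from b)) (proj₂ (e-from b)) ⟩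
      + toℕ (proj₂ (e-from b))                ∎))
      where open ≡-Reasoning
    Σ-≡ : ∀ {b b′} {p : f b ≡ + r} {q : f b′ ≡ + r} → b ≡ b′ → (b , p) ≡ (b′ , q)
    Σ-≡ {p = p} {q} refl = cong (_ ,_) (ℤ-≡-irrelevant p q)

module _ {A : Set} where

  tabulateℕ : (ℕ → A) → (k : ℕ) → Vec A k
  tabulateℕ g zero    = []
  tabulateℕ g (suc k) = g 0 ∷ tabulateℕ (g ∘ suc) k

  tabulateℕ-cong : ∀ k {g h : ℕ → A} → (∀ i → i < k → g i ≡ h i) → tabulateℕ g k ≡ tabulateℕ h k
  tabulateℕ-cong zero    g≗h = refl
  tabulateℕ-cong (suc k) g≗h = cong₂ _∷_ (g≗h 0 z<s) (tabulateℕ-cong k (λ i i<k → g≗h (suc i) (s<s i<k)))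

  -- Indices beyond the end read the last entry.
  lookupℕ : ∀ {k} → Vec A (suc k) → ℕ → A
  lookupℕ (a ∷ [])    _       = a
  lookupℕ (a ∷ b ∷ w) zero    = a
  lookupℕ (a ∷ b ∷ w) (suc i) = lookupℕ (b ∷ w) i

  tabulateℕ-lookupℕ : ∀ {k} (v : Vec A (suc k)) → tabulateℕ (lookupℕ v) (suc k) ≡ v
  tabulateℕ-lookupℕ (a ∷ [])    = refl
  tabulateℕ-lookupℕ (a ∷ b ∷ w) = cong (a ∷_) (tabulateℕ-lookupℕ (b ∷ w))

  lookupℕ-tabulateℕ : ∀ k (g : ℕ → A) {i} → i ≤ k → lookupℕ (tabulateℕ g (suc k)) i ≡ g i
  lookupℕ-tabulateℕ zero    g {zero}  _         = refl
  lookupℕ-tabulateℕ (suc k) g {zero}  _         = refl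
  lookupℕ-tabulateℕ (suc k) g {suc i} (s≤s i≤k) = lookupℕ-tabulateℕ k (g ∘ suc) i≤k

  lookupℕ-last : ∀ {k} (v : Vec A (suc k)) → lookupℕ v k ≡ last v
  lookupℕ-last (a ∷ [])    = refl
  lookupℕ-last (a ∷ b ∷ w) = lookupℕ-last (b ∷ w)

  All-lookupℕ : ∀ {P : A → Set} {k} {v : Vec A (suc k)} → All P v → ∀ i → P (lookupℕ v i)
  All-lookupℕ {v = a ∷ []}    (p ∷ [])  i       = p
  All-lookupℕ {v = a ∷ b ∷ w} (p ∷ ps)  zero    = p
  All-lookupℕ {v = a ∷ b ∷ w} (p ∷ ps)  (suc i) = All-lookupℕ ps i

  All-tabulateℕ : ∀ {P : A → Set} k {g : ℕ → A} → (∀ i → P (g i)) → All P (tabulateℕ g k)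
  All-tabulateℕ zero    Pg = []
  All-tabulateℕ (suc k) Pg = Pg 0 ∷ All-tabulateℕ k (Pg ∘ suc)

map-tabulateℕ : ∀ {A B : Set} k (f : A → B) (g : ℕ → A) → map f (tabulateℕ g k) ≡ tabulateℕ (f ∘ g) k
map-tabulateℕ zero    f g = refl
map-tabulateℕ (suc k) f g = cong (f (g 0) ∷_) (map-tabulateℕ k f (g ∘ suc))

sumℤ-tabulateℕ : ∀ k (f : ℕ → ℤ) → sumℤ (tabulateℕ f k) ≡ Sumℤ.∑ f k
sumℤ-tabulateℕ zero    f = refl
sumℤ-tabulateℕ (suc k) f = cong (λ s → f 0 ℤ.+ s) (sumℤ-tabulateℕ k (f ∘ suc))

last-map : ∀ {A B : Set} {k} (f : A → B) (v : Vec A (suc k)) → last (map f v) ≡ f (last v)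
last-map f (a ∷ [])    = refl
last-map f (a ∷ b ∷ w) = last-map f (b ∷ w)

zip-map-proj : ∀ {A B : Set} {k} (v : Vec (A × B) k) → zip (map proj₁ v) (map proj₂ v) ≡ v
zip-map-proj []            = refl
zip-map-proj ((a , b) ∷ v) = cong ((a , b) ∷_) (zip-map-proj v)

map-fixes : ∀ {A : Set} {k} (f : A → A) (v : Vec A k) → All (λ a → f a ≡ a) v → map f v ≡ v
map-fixes f []      []         = refl
map-fixes f (a ∷ v) (fa≡a ∷ e) = cong₂ _∷_ fa≡a (map-fixes f v e)

All-≤-sum : ∀ {k} (v : Vec ℕ k) → All (_≤ sum v) v
All-≤-sum []      = []
All-≤-sum (a ∷ v) = ℕ.m≤m+n a (sum v) ∷ All.map (λ a≤ → ℕ.≤-trans a≤ (ℕ.m≤n+m (sum v) a)) (All-≤-sum v)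

module Cyclic {A : Set} (n : ℕ) where

  cyclic : Vec A (suc n) → ℕ → A
  cyclic v t = lookupℕ v (t % suc n)

  cyclic-< : ∀ v {t} → t < suc n → cyclic v t ≡ lookupℕ v t
  cyclic-< v t<1+n = cong (lookupℕ v) (m<n⇒m%n≡m t<1+n)

  cyclic-periodic : ∀ v t → cyclic v (suc n + t) ≡ cyclic v t
  cyclic-periodic v t = cong (lookupℕ v) (trans (cong (_% suc n) (ℕ.+-comm (suc n) t)) ([m+n]%n≡m%n t (suc n)))

  rotate : ℕ → Vec A (suc n) → Vec A (suc n)
  rotate k v = tabulateℕ (λ i → cyclic v (k + i)) (suc n)

  cyclic-rotate : ∀ k v t → cyclic (rotate k v) t ≡ cyclic v (k + t)
  cyclic-rotate k v t = begin
    lookupℕ (rotate k v) (t % suc n)           ≡⟨ lookupℕ-tabulateℕ n (λ i → cyclic v (k + i)) (ℕ.≤-pred (m%n<n t (suc n))) ⟩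
    lookupℕ v ((k + t % suc n) % suc n)        ≡⟨ cong (lookupℕ v) (%-distribˡ-+ k (t % suc n) (suc n)) ⟩
    lookupℕ v ((k % suc n + t % suc n % suc n) % suc n)
      ≡⟨ cong (λ s → lookupℕ v ((k % suc n + s) % suc n)) (m%n%n≡m%n t (suc n)) ⟩
    lookupℕ v ((k % suc n + t % suc n) % suc n) ≡⟨ cong (lookupℕ v) (%-distribˡ-+ k t (suc n)) ⟨
    lookupℕ v ((k + t) % suc n)                ∎
    where open ≡-Reasoning

  rotate-rotate : ∀ a b v → rotate a (rotate b v) ≡ rotate (b + a) v
  rotate-rotate a b v = tabulateℕ-cong (suc n)
    (λ i _ → trans (cyclic-rotate b v (a + i)) (cong (cyclic v) (sym (ℕ.+-assoc b a i))))

  rotate-zero : ∀ v → rotate 0 v ≡ v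
  rotate-zero v = trans (tabulateℕ-cong (suc n) (λ i → cyclic-< v)) (tabulateℕ-lookupℕ v)

  rotate-period : ∀ v → rotate (suc n) v ≡ v
  rotate-period v = trans (tabulateℕ-cong (suc n) (λ i _ → cyclic-periodic v i)) (rotate-zero v)

  module _ (v : Vec A (suc n)) (f : A → ℤ) where

    ∑-cyclic : Sumℤ.∑ (f ∘ cyclic v) (suc n) ≡ sumℤ (map f v)
    ∑-cyclic = begin
      Sumℤ.∑ (f ∘ cyclic v) (suc n)                   ≡⟨ Sumℤ.∑-cong (suc n) (λ i i<1+n → cong f (cyclic-< v i<1+n)) ⟩
      Sumℤ.∑ (f ∘ lookupℕ v) (suc n)                  ≡⟨ sumℤ-tabulateℕ (suc n) (f ∘ lookupℕ v) ⟨
      sumℤ (tabulateℕ (f ∘ lookupℕ v) (suc n))        ≡⟨ cong sumℤ (map-tabulateℕ (suc n) f (lookupℕ v)) ⟨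
      sumℤ (map f (tabulateℕ (lookupℕ v) (suc n)))    ≡⟨ cong (sumℤ ∘ map f) (tabulateℕ-lookupℕ v) ⟩
      sumℤ (map f v)                                   ∎
      where open ≡-Reasoning

    ∑-cyclic-+ : ∀ t → Sumℤ.∑ (f ∘ cyclic v) (suc n + t) ≡ Sumℤ.∑ (f ∘ cyclic v) (suc n) ℤ.+ Sumℤ.∑ (f ∘ cyclic v) t
    ∑-cyclic-+ t = trans (Sumℤ.∑-+ (suc n) t (f ∘ cyclic v))
      (cong (λ s → Sumℤ.∑ (f ∘ cyclic v) (suc n) ℤ.+ s) (Sumℤ.∑-cong t (λ i _ → cong f (cyclic-periodic v i))))

    ∑-cyclic-window : ∀ k → Sumℤ.∑ (λ i → f (cyclic v (k + i))) (suc n) ≡ Sumℤ.∑ (f ∘ cyclic v) (suc n)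
    ∑-cyclic-window k = ∙-cancelˡ (Sumℤ.∑ (f ∘ cyclic v) k) _ _ (begin
      Sumℤ.∑ (f ∘ cyclic v) k ℤ.+ Sumℤ.∑ (λ i → f (cyclic v (k + i))) (suc n)
        ≡⟨ Sumℤ.∑-+ k (suc n) (f ∘ cyclic v) ⟨
      Sumℤ.∑ (f ∘ cyclic v) (k + suc n)       ≡⟨ cong (Sumℤ.∑ (f ∘ cyclic v)) (ℕ.+-comm k (suc n)) ⟩
      Sumℤ.∑ (f ∘ cyclic v) (suc n + k)       ≡⟨ ∑-cyclic-+ k ⟩
      Sumℤ.∑ (f ∘ cyclic v) (suc n) ℤ.+ Sumℤ.∑ (f ∘ cyclic v) k
        ≡⟨ ℤ.+-comm (Sumℤ.∑ (f ∘ cyclic v) (suc n)) _ ⟩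
      Sumℤ.∑ (f ∘ cyclic v) k ℤ.+ Sumℤ.∑ (f ∘ cyclic v) (suc n) ∎)
      where open ≡-Reasoning

    sumℤ-rotate : ∀ k → sumℤ (map f (rotate k v)) ≡ sumℤ (map f v)
    sumℤ-rotate k = begin
      sumℤ (map f (rotate k v))                              ≡⟨ cong sumℤ (map-tabulateℕ (suc n) f (λ i → cyclic v (k + i))) ⟩
      sumℤ (tabulateℕ (λ i → f (cyclic v (k + i))) (suc n))  ≡⟨ sumℤ-tabulateℕ (suc n) (λ i → f (cyclic v (k + i))) ⟩
      Sumℤ.∑ (λ i → f (cyclic v (k + i))) (suc n)            ≡⟨ ∑-cyclic-window k ⟩
      Sumℤ.∑ (f ∘ cyclic v) (suc n)                          ≡⟨ ∑-cyclic ⟩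
      sumℤ (map f v)                                          ∎
      where open ≡-Reasoning

-- Weak compositions

WeakComposition : ℕ → ℕ → Set
WeakComposition k s = Σ (Vec ℕ k) (λ v → sum v ≡ s)

WeakComposition-≡ : ∀ {k s} {a b : WeakComposition k s} → proj₁ a ≡ proj₁ b → a ≡ b
WeakComposition-≡ {a = v , e} {.v , e′} refl = cong (v ,_) (ℕ.≡-irrelevant e e′)

weakCompositions : ℕ → ℕ → ℕ
weakCompositions zero    zero    = 1
weakCompositions zero    (suc s) = 0
weakCompositions (suc k) zero    = weakCompositions k zero
weakCompositions (suc k) (suc s) = weakCompositions k (suc s) + weakCompositions (suc k) s

-- A weak composition either starts with 0 or comes from one of s - 1 by increasing its first part.
Fin↔WeakComposition : ∀ k s → Fin (weakCompositions k s) ↔ WeakComposition k s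
Fin↔WeakComposition zero    zero    =
  mk↔ₛ′ (λ _ → [] , refl) (λ _ → Fin.zero) (λ { ([] , refl) → refl }) (λ { Fin.zero → refl ; (Fin.suc ()) })
Fin↔WeakComposition zero    (suc s) = mk↔ₛ′ (λ ()) (λ { ([] , ()) }) (λ { ([] , ()) }) (λ ())
Fin↔WeakComposition (suc k) zero    =
  ↔-trans (Fin↔WeakComposition k zero) (mk↔ₛ′ from to (λ { (zero ∷ v , e) → refl }) (λ _ → refl))
  where
  to : WeakComposition (suc k) 0 → WeakComposition k 0
  to (zero ∷ v , e) = v , e
  from : WeakComposition k 0 → WeakComposition (suc k) 0
  from (v , e) = zero ∷ v , e
Fin↔WeakComposition (suc k) (suc s) =
  ↔-trans Fin.+↔⊎ (↔-trans (Fin↔WeakComposition k (suc s) ⊎-↔ Fin↔WeakComposition (suc k) s)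
                            (mk↔ₛ′ from to from-to to-from))
  where
  to : WeakComposition (suc k) (suc s) → WeakComposition k (suc s) ⊎ WeakComposition (suc k) s
  to (zero  ∷ v , e) = inj₁ (v , e)
  to (suc a ∷ v , e) = inj₂ (a ∷ v , ℕ.suc-injective e)
  from : WeakComposition k (suc s) ⊎ WeakComposition (suc k) s → WeakComposition (suc k) (suc s)
  from (inj₁ (v , e))     = zero ∷ v , e
  from (inj₂ (a ∷ v , e)) = suc a ∷ v , cong suc e
  to-from : ∀ c → to (from c) ≡ c
  to-from (inj₁ (v , e))     = refl
  to-from (inj₂ (a ∷ v , e)) = cong inj₂ (WeakComposition-≡ refl)
  from-to : ∀ c → from (to c) ≡ c
  from-to (zero  ∷ v , e) = refl
  from-to (suc a ∷ v , e) = WeakComposition-≡ refl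

weakCompositions≡C : ∀ k s → weakCompositions (suc k) s ≡ (s + k) C k
weakCompositions≡C zero    zero    = refl
weakCompositions≡C zero    (suc s) = weakCompositions≡C zero s
weakCompositions≡C (suc k) zero    = trans (weakCompositions≡C k zero) (trans (nCn≡1 k) (sym (nCn≡1 (suc k))))
weakCompositions≡C (suc k) (suc s) = begin
  weakCompositions (suc k) (suc s) + weakCompositions (suc (suc k)) s
    ≡⟨ cong₂ _+_ (weakCompositions≡C k (suc s)) (weakCompositions≡C (suc k) s) ⟩
  (suc s + k) C k + (s + suc k) C suc k     ≡⟨ cong (λ a → a C k + (s + suc k) C suc k) (ℕ.+-suc s k) ⟨
  (s + suc k) C k + (s + suc k) C suc k     ≡⟨ nCk+nC[k+1]≡[n+1]C[k+1] (s + suc k) k ⟩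
  suc (s + suc k) C suc k                   ∎
  where open ≡-Reasoning

sum-∷ʳ : ∀ {k} (v : Vec ℕ k) a → sum (v ∷ʳ a) ≡ sum v + a
sum-∷ʳ []      a = ℕ.+-identityʳ a
sum-∷ʳ (b ∷ v) a = trans (cong (λ t → b + t) (sum-∷ʳ v a)) (sym (ℕ.+-assoc b _ a))

init-∷ʳ-last : ∀ {A : Set} {k} (v : Vec A (suc k)) → v ≡ init v ∷ʳ last v
init-∷ʳ-last v = proj₂ (proj₂ (initLast v))

MarkedComposition : ℕ → ℕ → Set
MarkedComposition k s = Σ (WeakComposition (suc k) s) (λ c → Σ ℕ (λ J → J ≤ last (proj₁ c)))

MarkedComposition-≡ : ∀ {k s} {a b : MarkedComposition k s} →
  proj₁ (proj₁ a) ≡ proj₁ (proj₁ b) → proj₁ (proj₂ a) ≡ proj₁ (proj₂ b) → a ≡ b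
MarkedComposition-≡ {a = (v , e) , J , J≤} {(.v , e′) , .J , J≤′} refl refl
  rewrite ℕ.≡-irrelevant e e′ | ℕ.≤-irrelevant J≤ J≤′ = refl

-- The mark splits the last part a into J and a ∸ J.
MarkedComposition↔ : ∀ k s → MarkedComposition k s ↔ WeakComposition (suc (suc k)) s
MarkedComposition↔ k s = mk↔ₛ′ to from to-from from-to
  where
  to : MarkedComposition k s → WeakComposition (suc (suc k)) s
  to ((v , e) , J , J≤) = init v ∷ʳ J ∷ʳ (last v ∸ J) , (begin
    sum (init v ∷ʳ J ∷ʳ (last v ∸ J))       ≡⟨ sum-∷ʳ (init v ∷ʳ J) _ ⟩
    sum (init v ∷ʳ J) + (last v ∸ J)        ≡⟨ cong (_+ (last v ∸ J)) (sum-∷ʳ (init v) J) ⟩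
    sum (init v) + J + (last v ∸ J)         ≡⟨ ℕ.+-assoc (sum (init v)) J _ ⟩
    sum (init v) + (J + (last v ∸ J))       ≡⟨ cong (λ t → sum (init v) + t) (ℕ.m+[n∸m]≡n J≤) ⟩
    sum (init v) + last v                   ≡⟨ sum-∷ʳ (init v) (last v) ⟨
    sum (init v ∷ʳ last v)                  ≡⟨ cong sum (init-∷ʳ-last v) ⟨
    sum v                                   ≡⟨ e ⟩
    s                                       ∎)
    where open ≡-Reasoning
  from : WeakComposition (suc (suc k)) s → MarkedComposition k s
  from (u , e) = (init (init u) ∷ʳ (last (init u) + last u) , (begin
      sum (init (init u) ∷ʳ (last (init u) + last u))     ≡⟨ sum-∷ʳ (init (init u)) _ ⟩
      sum (init (init u)) + (last (init u) + last u)      ≡⟨ ℕ.+-assoc (sum (init (init u))) _ _ ⟨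
      sum (init (init u)) + last (init u) + last u        ≡⟨ cong (_+ last u) (sum-∷ʳ (init (init u)) (last (init u))) ⟨
      sum (init (init u) ∷ʳ last (init u)) + last u       ≡⟨ cong (λ w → sum w + last u) (init-∷ʳ-last (init u)) ⟨
      sum (init u) + last u                               ≡⟨ sum-∷ʳ (init u) (last u) ⟨
      sum (init u ∷ʳ last u)                              ≡⟨ cong sum (init-∷ʳ-last u) ⟨
      sum u                                               ≡⟨ e ⟩
      s                                                   ∎)) ,
    last (init u) , subst (last (init u) ≤_) (sym (Vec.last-∷ʳ _ (init (init u)))) (ℕ.m≤m+n _ _)
    where open ≡-Reasoning
  to-from : ∀ c → to (from c) ≡ c
  to-from (u , e) = WeakComposition-≡ (begin
    init w ∷ʳ a ∷ʳ (last w ∸ a)   ≡⟨ cong₂ (λ v l → v ∷ʳ a ∷ʳ (l ∸ a)) (Vec.init-∷ʳ (a + b) u′) (Vec.last-∷ʳ (a + b) u′) ⟩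
    u′ ∷ʳ a ∷ʳ (a + b ∸ a)        ≡⟨ cong (u′ ∷ʳ a ∷ʳ_) (ℕ.m+n∸m≡n a b) ⟩
    u′ ∷ʳ a ∷ʳ b                  ≡⟨ cong (_∷ʳ b) (init-∷ʳ-last (init u)) ⟨
    init u ∷ʳ b                   ≡⟨ init-∷ʳ-last u ⟨
    u                             ∎)
    where
    open ≡-Reasoning
    u′ : Vec ℕ k
    u′ = init (init u)
    a b : ℕ
    a = last (init u)
    b = last u
    w : Vec ℕ (suc k)
    w = u′ ∷ʳ (a + b)
  from-to : ∀ c → from (to c) ≡ c
  from-to ((v , e) , J , J≤) = MarkedComposition-≡
    (trans (cong₂ _∷ʳ_ init-init (cong₂ _+_ last-init last-w)) (trans (cong (init v ∷ʳ_) (ℕ.m+[n∸m]≡n J≤)) (sym (init-∷ʳ-last v))))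
    last-init
    where
    w = init v ∷ʳ J ∷ʳ (last v ∸ J)
    init-w : init w ≡ init v ∷ʳ J
    init-w = Vec.init-∷ʳ _ (init v ∷ʳ J)
    init-init : init (init w) ≡ init v
    init-init = trans (cong init init-w) (Vec.init-∷ʳ J (init v))
    last-init : last (init w) ≡ J
    last-init = trans (cong last init-w) (Vec.last-∷ʳ J (init v))
    last-w : last w ≡ last v ∸ J
    last-w = Vec.last-∷ʳ _ (init v ∷ʳ J)

-- Rotations of lattice paths and the cycle lemma

nplFrom-tabulateℕ : ∀ k acc (g : ℕ → ℤ × ℤ) →
  nplFrom acc (tabulateℕ g k) ≡ Sumℤ.∑ (λ i → ifNonPos (acc ℤ.+ Sumℤ.∑ (proj₂ ∘ g) (suc i)) (proj₁ (g i))) k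
nplFrom-tabulateℕ zero    acc g = refl
nplFrom-tabulateℕ (suc k) acc g = cong₂ ℤ._+_
  (cong (λ a → ifNonPos (acc ℤ.+ a) (proj₁ (g 0))) (sym (ℤ.+-identityʳ (proj₂ (g 0)))))
  (trans (nplFrom-tabulateℕ k (acc ℤ.+ proj₂ (g 0)) (g ∘ suc))
    (Sumℤ.∑-cong k (λ i _ → cong (λ a → ifNonPos a (proj₁ (g (suc i)))) (ℤ.+-assoc acc (proj₂ (g 0)) _))))

module Rotations (n m : ℕ) where
  open Cyclic {ℤ × ℤ} n public

  LatticePath-≡ : ∀ {P Q : LatticePath n m} → steps P ≡ steps Q → P ≡ Q
  LatticePath-≡ {mkPath s yb ys xb xs} {mkPath .s yb′ ys′ xb′ xs′} refl
    rewrite All.irrelevant ≤×≤-irrelevant yb yb′ | ℤ-≡-irrelevant ys ys′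
          | All.irrelevant ≤×≤-irrelevant xb xb′ | ℤ-≡-irrelevant xs xs′ = refl

  -- Opaque: keeps rotatePath k P rigid, so that k can be inferred from it; steps-rotatePath suffices.
  opaque
    rotatePath : ℕ → LatticePath n m → LatticePath n m
    rotatePath k P = mkPath (rotate k (steps P))
      (All-tabulateℕ (suc n) {g = λ i → cyclic (steps P) (k + i)} (λ i → All-lookupℕ (yBound P) ((k + i) % suc n)))
      (trans (sumℤ-rotate (steps P) proj₂ k) (ySum P))
      (All-tabulateℕ (suc n) {g = λ i → cyclic (steps P) (k + i)} (λ i → All-lookupℕ (xBound P) ((k + i) % suc n)))
      (trans (sumℤ-rotate (steps P) proj₁ k) (xSum P))

    steps-rotatePath : ∀ k P → steps (rotatePath k P) ≡ rotate k (steps P)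
    steps-rotatePath k P = refl

  rotatePath-rotatePath : ∀ a b P → rotatePath a (rotatePath b P) ≡ rotatePath (b + a) P
  rotatePath-rotatePath a b P = LatticePath-≡ (begin
    steps (rotatePath a (rotatePath b P))  ≡⟨ steps-rotatePath a _ ⟩
    rotate a (steps (rotatePath b P))      ≡⟨ cong (rotate a) (steps-rotatePath b P) ⟩
    rotate a (rotate b (steps P))          ≡⟨ rotate-rotate a b (steps P) ⟩
    rotate (b + a) (steps P)               ≡⟨ steps-rotatePath (b + a) P ⟨
    steps (rotatePath (b + a) P)           ∎)
    where open ≡-Reasoning

  rotatePath-period : ∀ P → rotatePath (suc n) P ≡ P
  rotatePath-period P = LatticePath-≡ (trans (steps-rotatePath (suc n) P) (rotate-period (steps P)))

module CycleLemma (n m : ℕ) (P : LatticePath n m) where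
  open Rotations n m

  x y : ℕ → ℤ
  x t = proj₁ (cyclic (steps P) t)
  y t = proj₂ (cyclic (steps P) t)

  Y : ℕ → ℤ
  Y = Sumℤ.∑ y

  1≤x : ∀ t → 1ℤ ℤ.≤ x t
  1≤x t = proj₁ (All-lookupℕ (xBound P) (t % suc n))

  x-period : ∀ t → x (suc n + t) ≡ x t
  x-period t = cong proj₁ (cyclic-periodic (steps P) t)

  Y-period : ∀ t → Y (suc n + t) ≡ 1ℤ ℤ.+ Y t
  Y-period t = trans (∑-cyclic-+ (steps P) proj₂ t) (cong (ℤ._+ Y t) (trans (∑-cyclic (steps P) proj₂) (ySum P)))

  lastX-rotatePath : ∀ k → lastX (rotatePath k P) ≡ x (k + n)
  lastX-rotatePath k = cong proj₁ (begin
    last (steps (rotatePath k P))        ≡⟨ cong last (steps-rotatePath k P) ⟩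
    last (rotate k (steps P))            ≡⟨ lookupℕ-last (rotate k (steps P)) ⟨
    lookupℕ (rotate k (steps P)) n       ≡⟨ lookupℕ-tabulateℕ n (λ i → cyclic (steps P) (k + i)) ℕ.≤-refl ⟩
    cyclic (steps P) (k + n)             ∎)
    where open ≡-Reasoning

  nplTerm : ℕ → ℕ → ℤ
  nplTerm k i = ifNonPos (Y (k + suc i) ℤ.- Y k) (x (k + i))

  NPL-rotatePath : ∀ k → NPL (rotatePath k P) ≡ Sumℤ.∑ (nplTerm k) (suc n)
  NPL-rotatePath k = begin
    NPL (rotatePath k P)                          ≡⟨ cong (nplFrom 0ℤ) (steps-rotatePath k P) ⟩
    nplFrom 0ℤ (rotate k (steps P))               ≡⟨ nplFrom-tabulateℕ (suc n) 0ℤ (λ i → cyclic (steps P) (k + i)) ⟩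
    Sumℤ.∑ (λ i → ifNonPos (0ℤ ℤ.+ window (suc i)) (x (k + i))) (suc n)
      ≡⟨ Sumℤ.∑-cong (suc n) (λ i _ → cong (λ a → ifNonPos a (x (k + i))) (rise (suc i))) ⟩
    Sumℤ.∑ (nplTerm k) (suc n)                    ∎
    where
    open ≡-Reasoning
    window : ℕ → ℤ
    window = Sumℤ.∑ (λ j → y (k + j))
    rise : ∀ t → 0ℤ ℤ.+ window t ≡ Y (k + t) ℤ.- Y k
    rise t = begin
      0ℤ ℤ.+ window t                        ≡⟨ ℤ.+-identityˡ _ ⟩
      window t                               ≡⟨ xyx⁻¹≈y (Y k) (window t) ⟨
      Y k ℤ.+ window t ℤ.- Y k               ≡⟨ cong (ℤ._- Y k) (Sumℤ.∑-+ k t y) ⟨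
      Y (k + t) ℤ.- Y k                      ∎

  StaysAbove : ℕ → Set
  StaysAbove k = ∀ i → i < suc n → Y k ℤ.< Y (k + suc i)

  StaysAbove⇒NPL≡0 : ∀ {k} → StaysAbove k → NPL (rotatePath k P) ≡ 0ℤ
  StaysAbove⇒NPL≡0 {k} above = trans (NPL-rotatePath k)
    (Sumℤ.∑-ε (suc n) (nplTerm k) (λ i i<1+n → ifNonPos-> _ (i<j⇒0<j-i (above i i<1+n))))

  nplTerm-nonNeg : ∀ k i → 0ℤ ℤ.≤ nplTerm k i
  nplTerm-nonNeg k i = ifNonPos-nonNeg (Y (k + suc i) ℤ.- Y k) (ℤ.≤-trans (ℤ.+≤+ z≤n) (1≤x (k + i)))

  -- Every term of the sum is nonnegative and the i-th one would be x ≥ 1 if the path dipped there.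
  NPL≡0⇒StaysAbove : ∀ {k} → NPL (rotatePath k P) ≡ 0ℤ → StaysAbove k
  NPL≡0⇒StaysAbove {k} npl≡0 i i<1+n with Y k ℤ.<? Y (k + suc i)
  ... | yes above = above
  ... | no  ¬above = contradiction (ℤ.≤-trans (1≤x (k + i)) x≤0) (ℤ.<⇒≱ (ℤ.+<+ z<s))
    where
    x≤0 : x (k + i) ℤ.≤ 0ℤ
    x≤0 = begin
      x (k + i)                       ≡⟨ ifNonPos-≤ (x (k + i)) (ℤ.i≤j⇒i-j≤0 (ℤ.≮⇒≥ ¬above)) ⟨
      nplTerm k i                     ≤⟨ ∑-nonNeg-≤ (suc n) (nplTerm k) (λ j _ → nplTerm-nonNeg k j) i i<1+n ⟩
      Sumℤ.∑ (nplTerm k) (suc n)      ≡⟨ trans (sym (NPL-rotatePath k)) npl≡0 ⟩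
      0ℤ                              ∎
      where open ℤ.≤-Reasoning

  private
    StaysAbove-< : ∀ {k₁ k₂} → k₁ < k₂ → k₂ ≤ n → StaysAbove k₁ → StaysAbove k₂ → ⊥
    StaysAbove-< {k₁} {k₂} k₁<k₂ k₂≤n above₁ above₂ =
      ℤ.<-irrefl refl (ℤ.<-≤-trans Yk₂<1+Yk₁ (ℤ.i<j⇒suc[i]≤j Yk₁<Yk₂))
      where
      Yk₁<Yk₂ : Y k₁ ℤ.< Y k₂
      Yk₁<Yk₂ = subst (λ t → Y k₁ ℤ.< Y t) (trans (ℕ.+-suc k₁ _) (ℕ.m+[n∸m]≡n k₁<k₂))
        (above₁ (k₂ ∸ suc k₁) (s≤s (ℕ.≤-trans (ℕ.m∸n≤m k₂ (suc k₁)) k₂≤n)))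
      wrap : ℕ
      wrap = n ∸ k₂ + k₁
      k₂+1+wrap : k₂ + suc wrap ≡ suc n + k₁
      k₂+1+wrap = trans (ℕ.+-suc k₂ wrap)
        (cong suc (trans (sym (ℕ.+-assoc k₂ (n ∸ k₂) k₁)) (cong (_+ k₁) (ℕ.m+[n∸m]≡n k₂≤n))))
      Yk₂<1+Yk₁ : Y k₂ ℤ.< 1ℤ ℤ.+ Y k₁
      Yk₂<1+Yk₁ = subst (Y k₂ ℤ.<_) (trans (cong Y k₂+1+wrap) (Y-period k₁))
        (above₂ wrap (s≤s (ℕ.≤-trans (ℕ.+-monoʳ-≤ (n ∸ k₂) (ℕ.<⇒≤ k₁<k₂)) (ℕ.≤-reflexive (ℕ.m∸n+n≡m k₂≤n)))))

  StaysAbove-unique : ∀ {k₁ k₂} → k₁ ≤ n → k₂ ≤ n → StaysAbove k₁ → StaysAbove k₂ → k₁ ≡ k₂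
  StaysAbove-unique {k₁} {k₂} k₁≤n k₂≤n above₁ above₂ with ℕ.<-cmp k₁ k₂
  ... | tri< k₁<k₂ _ _ = contradiction above₂ (StaysAbove-< k₁<k₂ k₂≤n above₁)
  ... | tri≈ _ k₁≡k₂ _ = k₁≡k₂
  ... | tri> _ _ k₂<k₁ = contradiction above₁ (StaysAbove-< k₂<k₁ k₁≤n above₂)

  -- The last point of minimal height in the first period.
  StaysAbove-exists : Σ ℕ λ k → k ≤ n × StaysAbove k
  StaysAbove-exists with lastArgmin Y n
  ... | k , k≤n , minimal , strict = k , k≤n , above
    where
    above : StaysAbove k
    above i i<1+n with k + suc i ℕ.≤? n
    ... | yes k+1+i≤n = strict (k + suc i) (ℕ.m<m+n k z<s) k+1+i≤n
    ... | no  k+1+i≰n = begin-strict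
      Y k                 <⟨ ℤ.suc[i]≤j⇒i<j ℤ.≤-refl ⟩
      1ℤ ℤ.+ Y k          ≤⟨ ℤ.+-monoʳ-≤ 1ℤ (minimal i′ i′≤n) ⟩
      1ℤ ℤ.+ Y i′         ≡⟨ Y-period i′ ⟨
      Y (suc n + i′)      ≡⟨ cong Y (ℕ.m+[n∸m]≡n (ℕ.≰⇒> k+1+i≰n)) ⟩
      Y (k + suc i)       ∎
      where
      open ℤ.≤-Reasoning
      i′ : ℕ
      i′ = k + suc i ∸ suc n
      i′≤n : i′ ≤ n
      i′≤n = ℕ.≤-trans (ℕ.∸-monoˡ-≤ (suc n) (ℕ.+-monoʳ-≤ k i<1+n)) (ℕ.≤-trans (ℕ.≤-reflexive (ℕ.m+n∸n≡m k (suc n))) k≤n)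

  cycleStart : ℕ
  cycleStart = proj₁ StaysAbove-exists

  cycleStart≤n : cycleStart ≤ n
  cycleStart≤n = proj₁ (proj₂ StaysAbove-exists)

  StaysAbove-cycleStart : StaysAbove cycleStart
  StaysAbove-cycleStart = proj₂ (proj₂ StaysAbove-exists)

-- Pointing a path with NPL 0 at each of the m points

module Blocks (n m : ℕ) (P : LatticePath n m) where
  open Rotations n m
  open CycleLemma n m P

  len : ℕ → ℕ
  len t = ∣ x t ∣

  +len≡x : ∀ t → + len t ≡ x t
  +len≡x t = ℤ.0≤i⇒+∣i∣≡i (ℤ.≤-trans (ℤ.+≤+ z≤n) (1≤x t))

  1≤len : ∀ t → 1 ≤ len t
  1≤len t = ℤ.drop‿+≤+ (subst (1ℤ ℤ.≤_) (sym (+len≡x t)) (1≤x t))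

  -- Step t of the path owns the points [X t, X (suc t)) of [0, m).
  X : ℕ → ℕ
  X = Sumℕ.∑ len

  X-suc : ∀ t → X (suc t) ≡ X t + len t
  X-suc t = Sumℕ.∑-suc t len

  X-total : X (suc n) ≡ m
  X-total = ℤ.+-injective (begin
    + X (suc n)                      ≡⟨ pos-∑ (suc n) len ⟩
    Sumℤ.∑ (λ i → + len i) (suc n)   ≡⟨ Sumℤ.∑-cong (suc n) (λ i _ → +len≡x i) ⟩
    Sumℤ.∑ x (suc n)                 ≡⟨ ∑-cyclic (steps P) proj₁ ⟩
    sumℤ (map proj₁ (steps P))       ≡⟨ xSum P ⟩
    + m                              ∎)
    where open ≡-Reasoning

  X-mono : ∀ {a b} → a ≤ b → X a ≤ X b
  X-mono {a} {b} a≤b = subst (λ s → X a ≤ X s) (ℕ.m+[n∸m]≡n a≤b)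
    (subst (X a ≤_) (sym (Sumℕ.∑-+ a (b ∸ a) len)) (ℕ.m≤m+n _ _))

  InBlock : ℕ → ℕ → Set
  InBlock t c = t ≤ n × X t ≤ c × c < X (suc t)

  InBlock⇒<m : ∀ {t c} → InBlock t c → c < m
  InBlock⇒<m (t≤n , _ , c<X) = subst (_ <_) X-total (ℕ.<-≤-trans c<X (X-mono (s≤s t≤n)))

  InBlock-+ : ∀ {t u} → t ≤ n → u < len t → InBlock t (X t + u)
  InBlock-+ {t} {u} t≤n u<len = t≤n , ℕ.m≤m+n _ _ , subst (X t + u <_) (sym (X-suc t)) (ℕ.+-monoʳ-< (X t) u<len)

  block : ℕ → ℕ
  block = stepOf X (suc n)

  InBlock-block : ∀ {c} → c < m → InBlock (block c) c
  InBlock-block c<m with stepOf-spec X (suc n) refl (subst (_ <_) (sym X-total) c<m)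
  ... | t<1+n , X≤c , c<X = ℕ.≤-pred t<1+n , X≤c , c<X

  block-unique : ∀ {t c} → InBlock t c → block c ≡ t
  block-unique {t} inb@(_ , X≤c , c<X) with InBlock-block (InBlock⇒<m inb)
  ... | _ , X′≤c , c<X′ = step-unique X X-mono X′≤c c<X′ X≤c c<X

  -- Points are ranked by the height reached at the end of their step, ties broken backwards.
  key : ℕ → ℤ
  key c = lexKey m (Y (suc (block c))) c

  key-InBlock : ∀ {t c} → InBlock t c → key c ≡ lexKey m (Y (suc t)) c
  key-InBlock inb = cong (λ s → lexKey m (Y (suc s)) _) (block-unique inb)

  open Ranking m key (λ c<m d<m → lexKey-injective c<m d<m) public

  module AtPoint {c : ℕ} (c<m : c < m) where

    t : ℕ
    t = block c

    t-InBlock : InBlock t c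
    t-InBlock = InBlock-block c<m

    blockCount : ℕ → ℕ
    blockCount t′ = count (λ u → below c (X t′ + u)) (len t′)

    rank≡∑blockCount : rank c ≡ Sumℕ.∑ blockCount (suc n)
    rank≡∑blockCount = trans (cong (count (below c)) (sym X-total)) (∑-blocks (indicator ∘ below c) len (suc n))

    below-InBlock : ∀ {t′ c′} {Q : Set} → InBlock t′ c′ →
      (Y (suc t′) ℤ.< Y (suc t) ⊎ (Y (suc t′) ≡ Y (suc t) × c < c′)) ⇔ Q → (Q? : Dec Q) → below c c′ ≡ does Q?
    below-InBlock {t′} {c′} inb lex⇔Q Q? = does-⇔ (mk⇔
      (to lex⇔Q ∘ to (lexKey-<⇔ (InBlock⇒<m inb) c<m) ∘ subst₂ ℤ._<_ (key-InBlock inb) (key-InBlock t-InBlock))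
      (subst₂ ℤ._<_ (sym (key-InBlock inb)) (sym (key-InBlock t-InBlock)) ∘ from (lexKey-<⇔ (InBlock⇒<m inb) c<m) ∘ from lex⇔Q))
      (key c′ ℤ.<? key c) Q?
      where open Equivalence

    blockCount-before : ∀ {t′} → t′ < t → blockCount t′ ≡ len t′ * indicator (does (Y (suc t′) ℤ.<? Y (suc t)))
    blockCount-before {t′} t′<t = count-const (len t′) (does (Y (suc t′) ℤ.<? Y (suc t))) λ u u<len →
      below-InBlock (InBlock-+ t′≤n u<len) (mk⇔ [ id , (λ (_ , c<c′) → contradiction (c′<c u<len) (ℕ.<-asym c<c′)) ] inj₁)
        (Y (suc t′) ℤ.<? Y (suc t))
      where
      t′≤n : t′ ≤ n
      t′≤n = ℕ.≤-trans (ℕ.<⇒≤ t′<t) (proj₁ t-InBlock)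
      c′<c : ∀ {u} → u < len t′ → X t′ + u < c
      c′<c u<len = ℕ.<-≤-trans (proj₂ (proj₂ (InBlock-+ t′≤n u<len))) (ℕ.≤-trans (X-mono t′<t) (proj₁ (proj₂ t-InBlock)))

    blockCount-after : ∀ {t′} → t < t′ → t′ ≤ n → blockCount t′ ≡ len t′ * indicator (does (Y (suc t′) ℤ.≤? Y (suc t)))
    blockCount-after {t′} t<t′ t′≤n = count-const (len t′) (does (Y (suc t′) ℤ.≤? Y (suc t))) λ u u<len →
      below-InBlock (InBlock-+ t′≤n u<len) (mk⇔ [ ℤ.<⇒≤ , ℤ.≤-reflexive ∘ proj₁ ] (≤⇒<⊎≡ (c<c′ u<len)))
        (Y (suc t′) ℤ.≤? Y (suc t))
      where
      c<c′ : ∀ {u} → u < len t′ → c < X t′ + u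
      c<c′ {u} _ = ℕ.<-≤-trans (proj₂ (proj₂ t-InBlock)) (ℕ.≤-trans (X-mono t<t′) (ℕ.m≤m+n (X t′) u))
      ≤⇒<⊎≡ : ∀ {c′} → c < c′ → Y (suc t′) ℤ.≤ Y (suc t) → Y (suc t′) ℤ.< Y (suc t) ⊎ (Y (suc t′) ≡ Y (suc t) × c < c′)
      ≤⇒<⊎≡ c<c′ Y′≤Y with Y (suc t′) ℤ.≟ Y (suc t)
      ... | yes Y′≡Y = inj₂ (Y′≡Y , c<c′)
      ... | no  Y′≢Y = inj₁ (ℤ.≤∧≢⇒< Y′≤Y Y′≢Y)

    pointer : ℕ
    pointer = X (suc t) ∸ suc c

    -- Within its own step, c is below exactly the points after it.
    blockCount-own : blockCount t ≡ pointer
    blockCount-own = begin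
      count p (len t)                                     ≡⟨ cong (count p) len≡ ⟩
      count p (suc d + pointer)                           ≡⟨ Sumℕ.∑-+ (suc d) pointer (indicator ∘ p) ⟩
      count p (suc d) + count (λ u → p (suc d + u)) pointer
        ≡⟨ cong₂ _+_ (count-const (suc d) false upTo-c) (count-const pointer true after-c) ⟩
      suc d * 0 + pointer * 1                            ≡⟨ cong₂ _+_ (ℕ.*-zeroʳ (suc d)) (ℕ.*-identityʳ pointer) ⟩
      pointer                                             ∎
      where
      open ≡-Reasoning
      t≤n : t ≤ n
      t≤n = proj₁ t-InBlock
      Xt≤c : X t ≤ c
      Xt≤c = proj₁ (proj₂ t-InBlock)
      c<Xt+1 : c < X (suc t)
      c<Xt+1 = proj₂ (proj₂ t-InBlock)
      p : ℕ → Bool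
      p u = below c (X t + u)
      d : ℕ
      d = c ∸ X t
      Xt+d≡c : X t + d ≡ c
      Xt+d≡c = ℕ.m+[n∸m]≡n Xt≤c
      Xt+1+d≡1+c : X t + suc d ≡ suc c
      Xt+1+d≡1+c = trans (ℕ.+-suc (X t) d) (cong suc Xt+d≡c)
      1+d≤len : suc d ≤ len t
      1+d≤len = ℕ.+-cancelˡ-< (X t) d (len t) (subst₂ _<_ (sym Xt+d≡c) (X-suc t) c<Xt+1)
      len≡ : len t ≡ suc d + pointer
      len≡ = sym (begin
        suc d + pointer                         ≡⟨ cong (λ s → suc d + (s ∸ suc c)) (X-suc t) ⟩
        suc d + (X t + len t ∸ suc c)           ≡⟨ cong (λ s → suc d + (X t + len t ∸ s)) Xt+1+d≡1+c ⟨
        suc d + (X t + len t ∸ (X t + suc d))   ≡⟨ cong (λ s → suc d + s) (ℕ.[m+n]∸[m+o]≡n∸o (X t) (len t) (suc d)) ⟩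
        suc d + (len t ∸ suc d)                 ≡⟨ ℕ.m+[n∸m]≡n 1+d≤len ⟩
        len t                                   ∎)
      own : ∀ {c′} → (Y (suc t) ℤ.< Y (suc t) ⊎ (Y (suc t) ≡ Y (suc t) × c < c′)) ⇔ (c < c′)
      own = mk⇔ [ (λ Y<Y → contradiction Y<Y (ℤ.<-irrefl refl)) , proj₂ ] (λ c<c′ → inj₂ (refl , c<c′))
      upTo-c : ∀ u → u < suc d → p u ≡ false
      upTo-c u u≤d = trans (below-InBlock (InBlock-+ t≤n (ℕ.<-≤-trans u≤d 1+d≤len)) own (c ℕ.<? X t + u))
        (dec-false (c ℕ.<? X t + u) (ℕ.≤⇒≯ (subst (X t + u ≤_) Xt+d≡c (ℕ.+-monoʳ-≤ (X t) (ℕ.≤-pred u≤d)))))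
      after-c : ∀ u → u < pointer → p (suc d + u) ≡ true
      after-c u u<E = trans (below-InBlock (InBlock-+ t≤n (subst (suc d + u <_) (sym len≡) (ℕ.+-monoʳ-< (suc d) u<E))) own
          (c ℕ.<? X t + (suc d + u)))
        (dec-true (c ℕ.<? X t + (suc d + u))
          (subst (c <_) (trans (cong (_+ u) (sym Xt+1+d≡1+c)) (ℕ.+-assoc (X t) (suc d) u)) (ℕ.m≤m+n (suc c) u)))

    private
      a : ℕ
      a = n ∸ t
      t≤n : t ≤ n
      t≤n = proj₁ t-InBlock
      a+1+t≡1+n : a + suc t ≡ suc n
      a+1+t≡1+n = trans (ℕ.+-suc a t) (cong suc (ℕ.m∸n+n≡m t≤n))
      afterSum beforeSum : ℕ
      afterSum  = Sumℕ.∑ (λ i → blockCount (suc t + i)) a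
      beforeSum = Sumℕ.∑ blockCount t

    rank≡ : rank c ≡ beforeSum + pointer + afterSum
    rank≡ = begin
      rank c                                                   ≡⟨ rank≡∑blockCount ⟩
      Sumℕ.∑ blockCount (suc n)                                ≡⟨ cong (Sumℕ.∑ blockCount) (trans (sym a+1+t≡1+n) (ℕ.+-comm a (suc t))) ⟩
      Sumℕ.∑ blockCount (suc t + a)                            ≡⟨ Sumℕ.∑-+ (suc t) a blockCount ⟩
      Sumℕ.∑ blockCount (suc t) + afterSum                     ≡⟨ cong (_+ afterSum) (Sumℕ.∑-suc t blockCount) ⟩
      beforeSum + blockCount t + afterSum                      ≡⟨ cong (λ s → beforeSum + s + afterSum) blockCount-own ⟩
      beforeSum + pointer + afterSum                           ∎
      where open ≡-Reasoning

    -- Rotating so that step t comes last, the steps after t are read first, then those before it.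
    NPL-rotatePath-after : NPL (rotatePath (suc t) P) ≡ + (afterSum + beforeSum)
    NPL-rotatePath-after = begin
      NPL (rotatePath (suc t) P)                                 ≡⟨ NPL-rotatePath (suc t) ⟩
      Sumℤ.∑ (nplTerm (suc t)) (suc n)                            ≡⟨ cong (Sumℤ.∑ (nplTerm (suc t))) (sym a+1+t≡1+n) ⟩
      Sumℤ.∑ (nplTerm (suc t)) (a + suc t)                        ≡⟨ Sumℤ.∑-+ a (suc t) (nplTerm (suc t)) ⟩
      Sumℤ.∑ (nplTerm (suc t)) a ℤ.+ Sumℤ.∑ wrapped (suc t)       ≡⟨ cong₂ ℤ._+_ first-part second-part ⟩
      + afterSum ℤ.+ + beforeSum                                  ≡⟨ ℤ.pos-+ afterSum beforeSum ⟨
      + (afterSum + beforeSum)                                    ∎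
      where
      open ≡-Reasoning
      wrapped : ℕ → ℤ
      wrapped j = nplTerm (suc t) (a + j)
      first-term : ∀ i → i < a → nplTerm (suc t) i ≡ + blockCount (suc t + i)
      first-term i i<a = begin
        ifNonPos (Y (suc t + suc i) ℤ.- Y (suc t)) (x (suc t + i))
          ≡⟨ cong₂ (λ s w → ifNonPos (Y s ℤ.- Y (suc t)) w) (ℕ.+-suc (suc t) i) (sym (+len≡x (suc t + i))) ⟩
        ifNonPos (Y (suc (suc t + i)) ℤ.- Y (suc t)) (+ len (suc t + i))
          ≡⟨ ifNonPos-≤? (Y (suc (suc t + i))) (Y (suc t)) (len (suc t + i)) ⟩
        + (len (suc t + i) * indicator (does (Y (suc (suc t + i)) ℤ.≤? Y (suc t))))
          ≡⟨ cong +_ (blockCount-after (s≤s (ℕ.m≤m+n t i)) (ℕ.≤-trans (ℕ.+-monoʳ-< t i<a) (ℕ.≤-reflexive (ℕ.m+[n∸m]≡n t≤n)))) ⟨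
        + blockCount (suc t + i) ∎
      first-part : Sumℤ.∑ (nplTerm (suc t)) a ≡ + afterSum
      first-part = trans (Sumℤ.∑-cong a first-term) (sym (pos-∑ a (λ i → blockCount (suc t + i))))
      1+t+[a+j]≡1+n+j : ∀ j → suc t + (a + j) ≡ suc n + j
      1+t+[a+j]≡1+n+j j = trans (sym (ℕ.+-assoc (suc t) a j)) (cong (_+ j) (trans (ℕ.+-comm (suc t) a) a+1+t≡1+n))
      wrapped≡ : ∀ j → wrapped j ≡ + (len j * indicator (does (Y (suc j) ℤ.<? Y (suc t))))
      wrapped≡ j = begin
        ifNonPos (Y (suc t + suc (a + j)) ℤ.- Y (suc t)) (x (suc t + (a + j)))
          ≡⟨ cong₂ (λ s w → ifNonPos (Y s ℤ.- Y (suc t)) w)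
               (trans (ℕ.+-suc (suc t) (a + j)) (trans (cong suc (1+t+[a+j]≡1+n+j j)) (sym (ℕ.+-suc (suc n) j))))
               (cong x (1+t+[a+j]≡1+n+j j)) ⟩
        ifNonPos (Y (suc n + suc j) ℤ.- Y (suc t)) (x (suc n + j))
          ≡⟨ cong₂ (λ h w → ifNonPos (h ℤ.- Y (suc t)) w) (Y-period (suc j)) (trans (x-period j) (sym (+len≡x j))) ⟩
        ifNonPos (1ℤ ℤ.+ Y (suc j) ℤ.- Y (suc t)) (+ len j)
          ≡⟨ ifNonPos-<? (Y (suc j)) (Y (suc t)) (len j) ⟩
        + (len j * indicator (does (Y (suc j) ℤ.<? Y (suc t))))  ∎
      second-part : Sumℤ.∑ wrapped (suc t) ≡ + beforeSum
      second-part = begin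
        Sumℤ.∑ wrapped (suc t)                         ≡⟨ Sumℤ.∑-suc t wrapped ⟩
        Sumℤ.∑ wrapped t ℤ.+ wrapped t
          ≡⟨ cong₂ ℤ._+_ (Sumℤ.∑-cong t (λ j j<t → trans (wrapped≡ j) (cong +_ (sym (blockCount-before j<t)))))
                         (trans (wrapped≡ t) (cong (λ b → + (len t * indicator b)) (dec-false (Y (suc t) ℤ.<? Y (suc t)) (ℤ.<-irrefl refl)))) ⟩
        Sumℤ.∑ (λ j → + blockCount j) t ℤ.+ + (len t * 0)   ≡⟨ cong₂ ℤ._+_ (sym (pos-∑ t blockCount)) (cong +_ (ℕ.*-zeroʳ (len t))) ⟩
        + beforeSum ℤ.+ 0ℤ                                  ≡⟨ ℤ.+-identityʳ _ ⟩
        + beforeSum                                         ∎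

    lastX-1≡ : lastX (rotatePath (suc t) P) ℤ.- 1ℤ ≡ + (len t ∸ 1)
    lastX-1≡ = begin
      lastX (rotatePath (suc t) P) ℤ.- 1ℤ   ≡⟨ cong (ℤ._- 1ℤ) (lastX-rotatePath (suc t)) ⟩
      x (suc t + n) ℤ.- 1ℤ                  ≡⟨ cong (λ s → x (suc s) ℤ.- 1ℤ) (ℕ.+-comm t n) ⟩
      x (suc n + t) ℤ.- 1ℤ                  ≡⟨ cong (ℤ._- 1ℤ) (trans (x-period t) (sym (+len≡x t))) ⟩
      + len t ℤ.- 1ℤ                        ≡⟨ ℤ.[+m]-[+n]≡m⊖n (len t) 1 ⟩
      len t ℤ.⊖ 1                           ≡⟨ ℤ.⊖-≥ (1≤len t) ⟩
      + (len t ∸ 1)                         ∎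
      where open ≡-Reasoning

    pointer≤ : + pointer ℤ.≤ lastX (rotatePath (suc t) P) ℤ.- 1ℤ
    pointer≤ = subst (+ pointer ℤ.≤_) (sym lastX-1≡) (ℤ.+≤+ (begin
      X (suc t) ∸ suc c           ≤⟨ ℕ.∸-monoʳ-≤ (X (suc t)) (s≤s (proj₁ (proj₂ t-InBlock))) ⟩
      X (suc t) ∸ suc (X t)       ≡⟨ cong (_∸ suc (X t)) (X-suc t) ⟩
      X t + len t ∸ suc (X t)     ≡⟨ cong (X t + len t ∸_) (ℕ.+-comm 1 (X t)) ⟩
      X t + len t ∸ (X t + 1)     ≡⟨ ℕ.[m+n]∸[m+o]≡n∸o (X t) (len t) 1 ⟩
      len t ∸ 1                   ∎))
      where open ℕ.≤-Reasoning

    pointedAt : PointedPath n m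
    pointedAt = pointed (rotatePath (suc t) P) (+ pointer) (ℤ.+≤+ z≤n) pointer≤

    PNPL-pointedAt : PNPL pointedAt ≡ + rank c
    PNPL-pointedAt = begin
      NPL (rotatePath (suc t) P) ℤ.+ + pointer      ≡⟨ cong (ℤ._+ + pointer) NPL-rotatePath-after ⟩
      + (afterSum + beforeSum) ℤ.+ + pointer        ≡⟨ ℤ.pos-+ (afterSum + beforeSum) pointer ⟨
      + (afterSum + beforeSum + pointer)            ≡⟨ cong +_ (ℕ.+-assoc afterSum beforeSum pointer) ⟩
      + (afterSum + (beforeSum + pointer))          ≡⟨ cong +_ (ℕ.+-comm afterSum (beforeSum + pointer)) ⟩
      + (beforeSum + pointer + afterSum)            ≡⟨ cong +_ rank≡ ⟨
      + rank c                                      ∎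
      where open ≡-Reasoning

module Decomposition (n m : ℕ) where
  open Rotations n m

  PointedPath-≡ : ∀ {A B : PointedPath n m} → path A ≡ path B → j A ≡ j B → A ≡ B
  PointedPath-≡ {pointed P i lo hi} {pointed .P .i lo′ hi′} refl refl
    rewrite ℤ.≤-irrelevant lo lo′ | ℤ.≤-irrelevant hi hi′ = refl

  ZeroNPL : Set
  ZeroNPL = Σ (LatticePath n m) (λ P → NPL P ≡ 0ℤ)

  ZeroNPL-≡ : ∀ {P Q : LatticePath n m} (P≡Q : P ≡ Q) (p : NPL P ≡ 0ℤ) (q : NPL Q ≡ 0ℤ) → (P , p) ≡ (Q , q)
  ZeroNPL-≡ refl p q = cong (_ ,_) (ℤ-≡-irrelevant p q)

  pointing : ZeroNPL × Fin m → PointedPath n m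
  pointing ((P , _) , i) = Blocks.AtPoint.pointedAt n m P (Fin.toℕ<n i)

  -- Undoing pointing, given the rotation k of w that has NPL 0: the last step of w is step n ∸ k there.
  module Unpointing (w : LatticePath n m) {k} (k≤n : k ≤ n) (npl≡0 : NPL (rotatePath k w) ≡ 0ℤ)
                    (J : ℕ) (J≤ : + J ℤ.≤ lastX w ℤ.- 1ℤ) where
    p : LatticePath n m
    p = rotatePath k w
    open Blocks n m p
    open CycleLemma n m p using (x)

    t : ℕ
    t = n ∸ k

    x-t : x t ≡ lastX w
    x-t = begin
      proj₁ (cyclic (steps (rotatePath k w)) t)     ≡⟨ cong (λ v → proj₁ (cyclic v t)) (steps-rotatePath k w) ⟩
      proj₁ (cyclic (rotate k (steps w)) t)         ≡⟨ cong proj₁ (cyclic-rotate k (steps w) t) ⟩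
      proj₁ (cyclic (steps w) (k + t))              ≡⟨ cong (proj₁ ∘ cyclic (steps w)) (ℕ.m+[n∸m]≡n k≤n) ⟩
      proj₁ (cyclic (steps w) n)                    ≡⟨ cong proj₁ (trans (cyclic-< (steps w) ℕ.≤-refl) (lookupℕ-last (steps w))) ⟩
      lastX w                                       ∎
      where open ≡-Reasoning

    1+J≤len : suc J ≤ len t
    1+J≤len = ℤ.drop‿+<+ (subst (+ J ℤ.<_) (trans (sym x-t) (sym (+len≡x t))) (≤-1⇒< J≤))

    c : ℕ
    c = X (suc t) ∸ suc J

    1+J≤X : suc J ≤ X (suc t)
    1+J≤X = ℕ.≤-trans 1+J≤len (subst (len t ≤_) (sym (X-suc t)) (ℕ.m≤n+m (len t) (X t)))

    c-InBlock : InBlock t c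
    c-InBlock = ℕ.m∸n≤m n k
              , subst (X t ≤_) (trans (sym (ℕ.+-∸-assoc (X t) 1+J≤len)) (cong (_∸ suc J) (sym (X-suc t)))) (ℕ.m≤m+n _ _)
              , ℕ.∸-monoʳ-< z<s 1+J≤X

    result : ZeroNPL × Fin m
    result = (p , npl≡0) , fromℕ< (InBlock⇒<m c-InBlock)

    rotatePath-back : rotatePath (suc t) p ≡ w
    rotatePath-back = begin
      rotatePath (suc t) (rotatePath k w)   ≡⟨ rotatePath-rotatePath (suc t) k w ⟩
      rotatePath (k + suc t) w              ≡⟨ cong (λ s → rotatePath s w) (trans (ℕ.+-suc k t) (cong suc (ℕ.m+[n∸m]≡n k≤n))) ⟩
      rotatePath (suc n) w                  ≡⟨ rotatePath-period w ⟩
      w                                     ∎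
      where open ≡-Reasoning

    pointing-result : pointing result ≡ pointed w (+ J) (ℤ.+≤+ z≤n) J≤
    pointing-result = pointedAt≡ _ (Fin.toℕ-fromℕ< (InBlock⇒<m c-InBlock))
      where
      pointedAt≡ : ∀ {c′} (c′<m : c′ < m) → c′ ≡ c → AtPoint.pointedAt c′<m ≡ pointed w (+ J) (ℤ.+≤+ z≤n) J≤
      pointedAt≡ c<m refl = PointedPath-≡ (trans (cong (λ s → rotatePath (suc s) p) block≡t) rotatePath-back)
        (cong +_ (trans (cong (λ s → X (suc s) ∸ suc c) block≡t) (m∸suc[m∸suc[n]]≡n 1+J≤X)))
        where
        block≡t : block c ≡ t
        block≡t = block-unique c-InBlock

  module UnpointingOf (A : PointedPath n m) where
    open CycleLemma n m (path A)

    ∣j∣≤ : + ∣ j A ∣ ℤ.≤ lastX (path A) ℤ.- 1ℤ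
    ∣j∣≤ = subst (ℤ._≤ lastX (path A) ℤ.- 1ℤ) (sym (ℤ.0≤i⇒+∣i∣≡i (jLow A))) (jHigh A)

    open Unpointing (path A) cycleStart≤n (StaysAbove⇒NPL≡0 StaysAbove-cycleStart) ∣ j A ∣ ∣j∣≤ public

  decompose : PointedPath n m → ZeroNPL × Fin m
  decompose = UnpointingOf.result

  pointing-decompose : ∀ A → pointing (decompose A) ≡ A
  pointing-decompose A = trans (UnpointingOf.pointing-result A) (PointedPath-≡ refl (ℤ.0≤i⇒+∣i∣≡i (jLow A)))

  decompose-pointing : ∀ B → decompose (pointing B) ≡ B
  decompose-pointing B@((P , npl≡0) , i) =
    result≡ (StaysAbove-unique cycleStart≤n (ℕ.m∸n≤m n t) StaysAbove-cycleStart above)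
      cycleStart≤n (StaysAbove⇒NPL≡0 StaysAbove-cycleStart) (UnpointingOf.∣j∣≤ (pointing B))
    where
    open Blocks.AtPoint n m P (Fin.toℕ<n i)
    w : LatticePath n m
    w = rotatePath (suc t) P
    open CycleLemma n m w
    t≤n : t ≤ n
    t≤n = proj₁ t-InBlock
    rotatePath-back : rotatePath (n ∸ t) w ≡ P
    rotatePath-back = begin
      rotatePath (n ∸ t) (rotatePath (suc t) P)   ≡⟨ rotatePath-rotatePath (n ∸ t) (suc t) P ⟩
      rotatePath (suc t + (n ∸ t)) P              ≡⟨ cong (λ s → rotatePath (suc s) P) (ℕ.m+[n∸m]≡n t≤n) ⟩
      rotatePath (suc n) P                        ≡⟨ rotatePath-period P ⟩
      P                                           ∎
      where open ≡-Reasoning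
    above : StaysAbove (n ∸ t)
    above = NPL≡0⇒StaysAbove (trans (cong NPL rotatePath-back) npl≡0)
    result≡ : ∀ {k} → k ≡ n ∸ t → ∀ k≤n npl≡0′ J≤ → Unpointing.result w {k} k≤n npl≡0′ pointer J≤ ≡ ((P , npl≡0) , i)
    result≡ refl k≤n npl≡0′ J≤ = cong₂ _,_ (ZeroNPL-≡ rotatePath-back npl≡0′ npl≡0) (Fin.toℕ-injective (begin
      toℕ (fromℕ< _)                                        ≡⟨ Fin.toℕ-fromℕ< _ ⟩
      Blocks.X n m (rotatePath (n ∸ t) w) (suc (n ∸ (n ∸ t))) ∸ suc pointer
        ≡⟨ cong₂ (λ Q s → Blocks.X n m Q (suc s) ∸ suc pointer) rotatePath-back (ℕ.m∸[m∸n]≡n t≤n) ⟩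
      Blocks.X n m P (suc t) ∸ suc pointer                  ≡⟨ m∸suc[m∸suc[n]]≡n (proj₂ (proj₂ t-InBlock)) ⟩
      toℕ i                                                 ∎))
      where open ≡-Reasoning

  pointing↔ : (ZeroNPL × Fin m) ↔ PointedPath n m
  pointing↔ = mk↔ₛ′ pointing decompose pointing-decompose decompose-pointing

module ByPNPL (n m : ℕ) where
  open Decomposition n m

  -- Renumbering the points of each path by their rank makes the Fin m coordinate equal to PNPL.
  rerank : (ZeroNPL × Fin m) ↔ (ZeroNPL × Fin m)
  rerank = mk↔ₛ′ to from to-from from-to
    where
    module R (P : ZeroNPL) = Blocks n m (proj₁ P)
    to from : ZeroNPL × Fin m → ZeroNPL × Fin m
    to   (P , r) = P , Inverse.from (R.rank↔ P) r
    from (P , i) = P , R.rankFin P i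
    to-from : ∀ s → to (from s) ≡ s
    to-from (P , i) = cong (P ,_) (Inverse.strictlyInverseʳ (R.rank↔ P) i)
    from-to : ∀ s → from (to s) ≡ s
    from-to (P , r) = cong (P ,_) (Inverse.strictlyInverseˡ (R.rank↔ P) r)

  byPNPL↔ : (ZeroNPL × Fin m) ↔ PointedPath n m
  byPNPL↔ = ↔-trans rerank pointing↔

  PNPL-byPNPL : ∀ P r → PNPL (Inverse.to byPNPL↔ (P , r)) ≡ + toℕ r
  PNPL-byPNPL (P , e) r = begin
    PNPL (AtPoint.pointedAt (Fin.toℕ<n i))      ≡⟨ AtPoint.PNPL-pointedAt (Fin.toℕ<n i) ⟩
    + rank (toℕ i)                              ≡⟨ cong +_ (toℕ-rankFin i) ⟨
    + toℕ (rankFin i)                           ≡⟨ cong (+_ ∘ toℕ) (Inverse.strictlyInverseˡ rank↔ r) ⟩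
    + toℕ r                                     ∎
    where
    open ≡-Reasoning
    open Blocks n m P
    i : Fin m
    i = Inverse.from rank↔ r

-- Counting pointed paths

-- Heights y ∈ [1 - n, 1] correspond to parts 1 - y ∈ [0, n].
module YSteps (n : ℕ) where

  YBound : ℤ → Set
  YBound y = ((1ℤ ℤ.- + n) ℤ.≤ y) × (y ℤ.≤ 1ℤ)

  YSteps : Set
  YSteps = Σ (Vec ℤ (suc n)) (λ ys → All YBound ys × sumℤ ys ≡ 1ℤ)

  YSteps-≡ : ∀ {a b : YSteps} → proj₁ a ≡ proj₁ b → a ≡ b
  YSteps-≡ {ys , p , q} {.ys , p′ , q′} refl rewrite All.irrelevant ≤×≤-irrelevant p p′ | ℤ-≡-irrelevant q q′ = refl

  toPart : ℤ → ℕ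
  toPart y = ∣ 1ℤ ℤ.- y ∣

  fromPart : ℕ → ℤ
  fromPart z = 1ℤ ℤ.- + z

  +toPart : ∀ y → y ℤ.≤ 1ℤ → + toPart y ≡ 1ℤ ℤ.- y
  +toPart y y≤1 = ℤ.0≤i⇒+∣i∣≡i (ℤ.i≤j⇒0≤j-i y≤1)

  fromPart-toPart : ∀ y → y ℤ.≤ 1ℤ → fromPart (toPart y) ≡ y
  fromPart-toPart y y≤1 = trans (cong (λ i → 1ℤ ℤ.- i) (+toPart y y≤1)) (1-[1-i] y)
    where
    1-[1-i] : ∀ i → 1ℤ ℤ.- (1ℤ ℤ.- i) ≡ i
    1-[1-i] = solve-∀

  toPart-fromPart : ∀ z → toPart (fromPart z) ≡ z
  toPart-fromPart z = cong ∣_∣ (1-[1-i] (+ z))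
    where
    1-[1-i] : ∀ i → 1ℤ ℤ.- (1ℤ ℤ.- i) ≡ i
    1-[1-i] = solve-∀

  sum-toPart : ∀ {k} (ys : Vec ℤ k) → All YBound ys → + sum (map toPart ys) ≡ + k ℤ.- sumℤ ys
  sum-toPart []       []              = refl
  sum-toPart {suc k} (y ∷ ys) ((_ , y≤1) ∷ bs) = begin
    + (toPart y + sum (map toPart ys))               ≡⟨ ℤ.pos-+ (toPart y) _ ⟩
    + toPart y ℤ.+ + sum (map toPart ys)             ≡⟨ cong₂ ℤ._+_ (+toPart y y≤1) (sum-toPart ys bs) ⟩
    (1ℤ ℤ.- y) ℤ.+ (+ k ℤ.- sumℤ ys)             ≡⟨ regroup y (+ k) (sumℤ ys) ⟩
    (1ℤ ℤ.+ + k) ℤ.- (y ℤ.+ sumℤ ys)             ∎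
    where
    open ≡-Reasoning
    regroup : ∀ y K S → (1ℤ ℤ.- y) ℤ.+ (K ℤ.- S) ≡ (1ℤ ℤ.+ K) ℤ.- (y ℤ.+ S)
    regroup = solve-∀

  sum-fromPart : ∀ {k} (zs : Vec ℕ k) → sumℤ (map fromPart zs) ≡ + k ℤ.- + sum zs
  sum-fromPart []       = refl
  sum-fromPart {suc k} (z ∷ zs) = begin
    fromPart z ℤ.+ sumℤ (map fromPart zs)            ≡⟨ cong (λ s → fromPart z ℤ.+ s) (sum-fromPart zs) ⟩
    (1ℤ ℤ.- + z) ℤ.+ (+ k ℤ.- + sum zs)          ≡⟨ regroup (+ z) (+ k) (+ sum zs) ⟩
    (1ℤ ℤ.+ + k) ℤ.- (+ z ℤ.+ + sum zs)          ≡⟨ cong (λ i → (1ℤ ℤ.+ + k) ℤ.- i) (ℤ.pos-+ z (sum zs)) ⟨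
    + suc k ℤ.- + (z + sum zs)                    ∎
    where
    open ≡-Reasoning
    regroup : ∀ Z K S → (1ℤ ℤ.- Z) ℤ.+ (K ℤ.- S) ≡ (1ℤ ℤ.+ K) ℤ.- (Z ℤ.+ S)
    regroup = solve-∀

  YBound-fromPart : ∀ {z} → z ≤ n → YBound (fromPart z)
  YBound-fromPart {z} z≤bound = ℤ.+-monoʳ-≤ 1ℤ (ℤ.neg-mono-≤ (ℤ.+≤+ z≤bound)) , ℤ.i-j≤i 1ℤ (+ z)

  YSteps↔ : YSteps ↔ WeakComposition (suc n) n
  YSteps↔ = mk↔ₛ′ to from to-from from-to
    where
    to : YSteps → WeakComposition (suc n) n
    to (ys , bs , Σys≡1) = map toPart ys
      , ℤ.+-injective (trans (sum-toPart ys bs) (trans (cong (λ i → + suc n ℤ.- i) Σys≡1) (1+N-1 (+ n))))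
      where
      1+N-1 : ∀ N → (1ℤ ℤ.+ N) ℤ.- 1ℤ ≡ N
      1+N-1 = solve-∀
    from : WeakComposition (suc n) n → YSteps
    from (zs , Σzs≡n) = map fromPart zs
      , All.map⁺ (All.map (λ {z} z≤Σ → YBound-fromPart (subst (z ≤_) Σzs≡n z≤Σ)) (All-≤-sum zs))
      , trans (sum-fromPart zs) (trans (cong (λ s → + suc n ℤ.- + s) Σzs≡n) (1+N-N (+ n)))
      where
      1+N-N : ∀ N → (1ℤ ℤ.+ N) ℤ.- N ≡ 1ℤ
      1+N-N = solve-∀
    to-from : ∀ c → to (from c) ≡ c
    to-from (zs , _) = WeakComposition-≡ (trans (sym (Vec.map-∘ toPart fromPart zs))
      (map-fixes (toPart ∘ fromPart) zs (All.universal toPart-fromPart zs)))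
    from-to : ∀ c → from (to c) ≡ c
    from-to (ys , bs , _) = YSteps-≡ (trans (sym (Vec.map-∘ fromPart toPart ys))
      (map-fixes (fromPart ∘ toPart) ys (All.map (λ {y} b → fromPart-toPart y (proj₂ b)) bs)))

-- Steps x ∈ [1, m - 1] correspond to parts x - 1; the pointer j splits the last part.
module PointedXSteps (n m : ℕ) (1≤n : 1 ≤ n) (n<m : suc n ≤ m) where

  XBound : ℤ → Set
  XBound x = (1ℤ ℤ.≤ x) × (x ℤ.≤ + m ℤ.- 1ℤ)

  XSteps : Set
  XSteps = Σ (Vec ℤ (suc n)) (λ xs → All XBound xs × sumℤ xs ≡ + m)

  PointedXSteps : Set
  PointedXSteps = Σ XSteps (λ X → Σ ℤ (λ i → (0ℤ ℤ.≤ i) × (i ℤ.≤ last (proj₁ X) ℤ.- 1ℤ)))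

  PointedXSteps-≡ : ∀ {a b : PointedXSteps} → proj₁ (proj₁ a) ≡ proj₁ (proj₁ b) → proj₁ (proj₂ a) ≡ proj₁ (proj₂ b) → a ≡ b
  PointedXSteps-≡ {(xs , p , q) , i , r , s} {(.xs , p′ , q′) , .i , r′ , s′} refl refl
    rewrite All.irrelevant ≤×≤-irrelevant p p′ | ℤ-≡-irrelevant q q′ | ℤ.≤-irrelevant r r′ | ℤ.≤-irrelevant s s′ = refl

  toPart : ℤ → ℕ
  toPart x = ∣ x ℤ.- 1ℤ ∣

  fromPart : ℕ → ℤ
  fromPart a = + a ℤ.+ 1ℤ

  +toPart : ∀ x → 1ℤ ℤ.≤ x → + toPart x ≡ x ℤ.- 1ℤ
  +toPart x 1≤x = ℤ.0≤i⇒+∣i∣≡i (ℤ.i≤j⇒0≤j-i 1≤x)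

  fromPart-toPart : ∀ x → 1ℤ ℤ.≤ x → fromPart (toPart x) ≡ x
  fromPart-toPart x 1≤x = trans (cong (ℤ._+ 1ℤ) (+toPart x 1≤x)) (i-1+1 x)
    where
    i-1+1 : ∀ i → (i ℤ.- 1ℤ) ℤ.+ 1ℤ ≡ i
    i-1+1 = solve-∀

  toPart-fromPart : ∀ a → toPart (fromPart a) ≡ a
  toPart-fromPart a = cong ∣_∣ (i+1-1 (+ a))
    where
    i+1-1 : ∀ i → (i ℤ.+ 1ℤ) ℤ.- 1ℤ ≡ i
    i+1-1 = solve-∀

  sum-toPart : ∀ {k} (xs : Vec ℤ k) → All XBound xs → + sum (map toPart xs) ≡ sumℤ xs ℤ.- + k
  sum-toPart []       []              = refl
  sum-toPart {suc k} (x ∷ xs) ((1≤x , _) ∷ bs) = begin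
    + (toPart x + sum (map toPart xs))           ≡⟨ ℤ.pos-+ (toPart x) _ ⟩
    + toPart x ℤ.+ + sum (map toPart xs)         ≡⟨ cong₂ ℤ._+_ (+toPart x 1≤x) (sum-toPart xs bs) ⟩
    (x ℤ.- 1ℤ) ℤ.+ (sumℤ xs ℤ.- + k)             ≡⟨ regroup x (+ k) (sumℤ xs) ⟩
    (x ℤ.+ sumℤ xs) ℤ.- (1ℤ ℤ.+ + k)             ∎
    where
    open ≡-Reasoning
    regroup : ∀ x K S → (x ℤ.- 1ℤ) ℤ.+ (S ℤ.- K) ≡ (x ℤ.+ S) ℤ.- (1ℤ ℤ.+ K)
    regroup = solve-∀

  sum-fromPart : ∀ {k} (as : Vec ℕ k) → sumℤ (map fromPart as) ≡ + sum as ℤ.+ + k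
  sum-fromPart []       = refl
  sum-fromPart {suc k} (a ∷ as) = begin
    fromPart a ℤ.+ sumℤ (map fromPart as)        ≡⟨ cong (λ s → fromPart a ℤ.+ s) (sum-fromPart as) ⟩
    (+ a ℤ.+ 1ℤ) ℤ.+ (+ sum as ℤ.+ + k)          ≡⟨ regroup (+ a) (+ k) (+ sum as) ⟩
    (+ a ℤ.+ + sum as) ℤ.+ (1ℤ ℤ.+ + k)          ≡⟨ cong (ℤ._+ + suc k) (ℤ.pos-+ a (sum as)) ⟨
    + (a + sum as) ℤ.+ + suc k                    ∎
    where
    open ≡-Reasoning
    regroup : ∀ A K S → (A ℤ.+ 1ℤ) ℤ.+ (S ℤ.+ K) ≡ (A ℤ.+ S) ℤ.+ (1ℤ ℤ.+ K)
    regroup = solve-∀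

  -- This is where 1 ≤ n is needed: parts are at most m - (n + 1), so steps are at most m - 1.
  XBound-fromPart : ∀ {a} → a ≤ m ∸ suc n → XBound (fromPart a)
  XBound-fromPart {a} a≤ = subst (1ℤ ℤ.≤_) (ℤ.pos-+ a 1) (ℤ.+≤+ (ℕ.m≤n+m 1 a))
    , subst₂ ℤ._≤_ (ℤ.pos-+ a 1) (sym m-1) (ℤ.+≤+ (begin
        a + 1               ≤⟨ ℕ.+-monoˡ-≤ 1 a≤ ⟩
        m ∸ suc n + 1       ≤⟨ ℕ.+-monoˡ-≤ 1 (ℕ.∸-monoʳ-≤ m (s≤s 1≤n)) ⟩
        m ∸ 2 + 1           ≡⟨ m∸2+1 ⟩
        m ∸ 1               ∎))
    where
    open ℕ.≤-Reasoning
    2≤m : 2 ≤ m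
    2≤m = ℕ.≤-trans (s≤s 1≤n) n<m
    m-1 : + m ℤ.- 1ℤ ≡ + (m ∸ 1)
    m-1 = trans (ℤ.[+m]-[+n]≡m⊖n m 1) (ℤ.⊖-≥ (ℕ.≤-trans (s≤s z≤n) n<m))
    m∸2+1 : m ∸ 2 + 1 ≡ m ∸ 1
    m∸2+1 = trans (sym (ℕ.+-∸-comm 1 2≤m)) (cong (_∸ 2) (ℕ.+-comm m 1))

  All-XBound-last : ∀ {k} {v : Vec ℤ (suc k)} → All XBound v → 1ℤ ℤ.≤ last v
  All-XBound-last {v = _ ∷ []}    (b ∷ [])  = proj₁ b
  All-XBound-last {v = _ ∷ _ ∷ _} (_ ∷ bs)  = All-XBound-last bs

  PointedXSteps↔ : PointedXSteps ↔ MarkedComposition n (m ∸ suc n)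
  PointedXSteps↔ = mk↔ₛ′ to from to-from from-to
    where
    to : PointedXSteps → MarkedComposition n (m ∸ suc n)
    to ((xs , bs , Σxs≡m) , i , 0≤i , i≤) =
      (map toPart xs , ℤ.+-injective (trans (sum-toPart xs bs) (trans (cong (ℤ._- + suc n) Σxs≡m)
        (trans (ℤ.[+m]-[+n]≡m⊖n m (suc n)) (ℤ.⊖-≥ n<m))))) ,
      ∣ i ∣ , subst (∣ i ∣ ≤_) (sym (last-map toPart xs))
        (ℤ.drop‿+≤+ (subst₂ ℤ._≤_ (sym (ℤ.0≤i⇒+∣i∣≡i 0≤i)) (sym (+toPart (last xs) (All-XBound-last bs))) i≤))
    from : MarkedComposition n (m ∸ suc n) → PointedXSteps
    from ((as , Σas≡) , J , J≤) =
      (map fromPart as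
        , All.map⁺ (All.map (λ {a} a≤Σ → XBound-fromPart (subst (a ≤_) Σas≡ a≤Σ)) (All-≤-sum as))
        , trans (sum-fromPart as) (trans (cong (λ s → + s ℤ.+ + suc n) Σas≡)
            (trans (sym (ℤ.pos-+ (m ∸ suc n) (suc n))) (cong +_ (ℕ.m∸n+n≡m n<m))))) ,
      + J , ℤ.+≤+ z≤n , subst (+ J ℤ.≤_) (sym (trans (cong (ℤ._- 1ℤ) (last-map fromPart as)) (i+1-1 (+ last as)))) (ℤ.+≤+ J≤)
      where
      i+1-1 : ∀ i → (i ℤ.+ 1ℤ) ℤ.- 1ℤ ≡ i
      i+1-1 = solve-∀
    to-from : ∀ c → to (from c) ≡ c
    to-from ((as , _) , J , _) = MarkedComposition-≡
      (trans (sym (Vec.map-∘ toPart fromPart as)) (map-fixes (toPart ∘ fromPart) as (All.universal toPart-fromPart as))) refl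
    from-to : ∀ c → from (to c) ≡ c
    from-to ((xs , bs , _) , i , 0≤i , _) = PointedXSteps-≡
      (trans (sym (Vec.map-∘ fromPart toPart xs))
        (map-fixes (fromPart ∘ toPart) xs (All.map (λ {x} b → fromPart-toPart x (proj₁ b)) bs)))
      (ℤ.0≤i⇒+∣i∣≡i 0≤i)

module Unzipping (n m : ℕ) (1≤n : 1 ≤ n) (n<m : suc n ≤ m) where
  open YSteps n
  open PointedXSteps n m 1≤n n<m
  open Decomposition n m using (PointedPath-≡)
  open Rotations n m using (LatticePath-≡)

  PointedPath↔ : PointedPath n m ↔ (YSteps × PointedXSteps)
  PointedPath↔ = mk↔ₛ′ to from to-from from-to
    where
    lastX≡ : ∀ (st : Vec (ℤ × ℤ) (suc n)) → proj₁ (last st) ≡ last (map proj₁ st)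
    lastX≡ st = sym (last-map proj₁ st)
    to : PointedPath n m → YSteps × PointedXSteps
    to (pointed (mkPath st yb ys xb xs) i 0≤i i≤) =
      (map proj₂ st , All.map⁺ yb , ys) ,
      ((map proj₁ st , All.map⁺ xb , xs) , i , 0≤i , subst (λ z → i ℤ.≤ z ℤ.- 1ℤ) (lastX≡ st) i≤)
    from : YSteps × PointedXSteps → PointedPath n m
    from ((ys , yb , Σys) , ((xs , xb , Σxs) , i , 0≤i , i≤)) =
      pointed (mkPath (zip xs ys)
        (All.map⁻ (subst (All YBound) (sym (Vec.map-proj₂-zip xs ys)) yb))
        (trans (cong sumℤ (Vec.map-proj₂-zip xs ys)) Σys)
        (All.map⁻ (subst (All XBound) (sym (Vec.map-proj₁-zip xs ys)) xb))
        (trans (cong sumℤ (Vec.map-proj₁-zip xs ys)) Σxs))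
        i 0≤i (subst (λ z → i ℤ.≤ z ℤ.- 1ℤ) (sym (trans (lastX≡ (zip xs ys)) (cong last (Vec.map-proj₁-zip xs ys)))) i≤)
    to-from : ∀ c → to (from c) ≡ c
    to-from ((ys , _) , ((xs , _) , _)) =
      cong₂ _,_ (YSteps-≡ (Vec.map-proj₂-zip xs ys)) (PointedXSteps-≡ (Vec.map-proj₁-zip xs ys) refl)
    from-to : ∀ a → from (to a) ≡ a
    from-to (pointed (mkPath st _ _ _ _) _ _ _) = PointedPath-≡ (LatticePath-≡ (zip-map-proj st)) refl

module Counting (n m : ℕ) (1≤n : 1 ≤ n) (n<m : suc n ≤ m) where
  open Decomposition n m
  open ByPNPL n m

  Fin↔PointedPath : Fin (((2 * n) C n) * (m C suc n)) ↔ PointedPath n m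
  Fin↔PointedPath = subst (λ k → Fin k ↔ PointedPath n m) total≡
    (↔-trans Fin.*↔× (↔-trans (Fin↔YSteps ×-↔ Fin↔PointedXSteps) (↔-sym (Unzipping.PointedPath↔ n m 1≤n n<m))))
    where
    Fin↔YSteps : Fin (weakCompositions (suc n) n) ↔ YSteps.YSteps n
    Fin↔YSteps = ↔-trans (Fin↔WeakComposition (suc n) n) (↔-sym (YSteps.YSteps↔ n))
    Fin↔PointedXSteps : Fin (weakCompositions (suc (suc n)) (m ∸ suc n)) ↔ PointedXSteps.PointedXSteps n m 1≤n n<m
    Fin↔PointedXSteps = ↔-trans (Fin↔WeakComposition (suc (suc n)) (m ∸ suc n))
      (↔-trans (↔-sym (MarkedComposition↔ n (m ∸ suc n))) (↔-sym (PointedXSteps.PointedXSteps↔ n m 1≤n n<m)))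
    total≡ : weakCompositions (suc n) n * weakCompositions (suc (suc n)) (m ∸ suc n) ≡ ((2 * n) C n) * (m C suc n)
    total≡ = cong₂ _*_ y-count x-count
      where
      y-count : weakCompositions (suc n) n ≡ (2 * n) C n
      y-count = trans (weakCompositions≡C n n) (cong (λ k → (n + k) C n) (sym (ℕ.+-identityʳ n)))
      x-count : weakCompositions (suc (suc n)) (m ∸ suc n) ≡ m C suc n
      x-count = trans (weakCompositions≡C (suc n) (m ∸ suc n)) (cong (_C suc n) (ℕ.m∸n+n≡m n<m))

  PNPL-fibre↔ : ∀ {r} → r < m → PointedWithPNPL n m (+ r) ↔ ZeroNPL
  PNPL-fibre↔ = fibre↔ byPNPL↔ PNPL (λ P r → PNPL-byPNPL P r)

  ZeroNPL-finite : Σ ℕ λ N → Fin N ↔ ZeroNPL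
  ZeroNPL-finite = N , ↔-trans Fin-N↔ (↔-trans (Σ-↔ Fin↔PointedPath ↔-refl) (PNPL-fibre↔ (ℕ.≤-trans (s≤s z≤n) n<m)))
    where
    open Inverse Fin↔PointedPath using (to)
    filtered : Σ ℕ λ N → Fin N ↔ Σ (Fin _) (λ k → PNPL (to k) ≡ + 0)
    filtered = Σ-Fin-filter _ (λ k → PNPL (to k) ≡ + 0) (λ k → PNPL (to k) ℤ.≟ + 0) (λ _ → ℤ-≡-irrelevant)
    N : ℕ
    N = proj₁ filtered
    Fin-N↔ : Fin N ↔ Σ (Fin _) (λ k → PNPL (to k) ≡ + 0)
    Fin-N↔ = proj₂ filtered

  m*size-ZeroNPL : ∀ {N} → Fin N ↔ ZeroNPL → m * N ≡ ((2 * n) C n) * (m C suc n)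
  m*size-ZeroNPL {N} Fin-N↔ = trans (ℕ.*-comm m N)
    (↔⇒≡ (↔-trans Fin.*↔× (↔-trans (Fin-N↔ ×-↔ ↔-refl) (↔-trans pointing↔ (↔-sym Fin↔PointedPath)))))

corollary3p9 : (n m : ℕ) → 1 ≤ n → suc n ≤ m →
    Σ ℕ (λ N →
    (m * N ≡ ((2 * n) C n) * (m C suc n)) ×
    ((r : ℕ) → r < m → Fin N ↔ PointedWithPNPL n m (+ r)))
corollary3p9 n m 1≤n n<m = N , m*size-ZeroNPL Fin-N↔ , λ r r<m → ↔-trans Fin-N↔ (↔-sym (PNPL-fibre↔ r<m))
  where
  open Counting n m 1≤n n<m
  N : ℕ
  N = proj₁ ZeroNPL-finite
  Fin-N↔ : Fin N ↔ Decomposition.ZeroNPL n m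
  Fin-N↔ = proj₂ ZeroNPL-finite
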